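{- Let $G$ be a subcubic graph of order $n$. Then every connected coalition partition of $G$ has at most $\max\{6,\lfloor (n+7)/3\rfloor\}$ sets, i.e. $CC(G)\le \max\{6,\lfloor (n+7)/3\rfloor\}$. Moreover, if $CC(G)=k>6$, then for every connected coalition partition $\pi$ of $G$ with $k$ sets, $CCG(G,\pi)\cong S_k$. The bound is sharp: for every $n\in\{6,8\}$ and every $n\ge 10$ there is a subcubic graph $G$ of order $n$ with $CC(G)=\max\{6,\lfloor (n+7)/3\rfloor\}$.
   Context: All graphs are finite and simple. A graph is subcubic if it is connected and its maximum vertex degree is at most 3. For a graph $G$ with vertex set $V$ and $S\subseteq V$, $G[S]$ denotes the induced subgraph. A set $D\subseteq V$ is dominating if every vertex of $V\setminus D$ has a neighbour in $D$; it is a connected dominating set if moreover $G[D]$ is connected. Two disjoint subsets $A,B\subseteq V$ form a connected coalition if neither $A$ nor $B$ is a connected dominating set but $A\cup B$ is a connected dominating set. A connected coalition partition of $G$ is a partition $\pi=\{V_1,\dots,V_k\}$ of $V$ such that each $V_i$ either is a connected dominating set consisting of a single vertex, or forms a connected coalition with some set of $\pi$. The coalition graph $CCG(G,\pi)$ has vertex set $\{V_1,\dots,V_k\}$, with $V_i$ and $V_j$ adjacent if and only if they form a connected coalition in $G$. The connected coalition number $CC(G)$ is the largest number of sets in a connected coalition partition of $G$. $S_k$ denotes the star of order $k$ (i.e. $K_{1,k-1}$). -}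

module Defs where

open import Data.Nat using (ℕ; _≤_; _<_; _⊔_; _+_)
open import Data.Nat.DivMod using (_/_)
open import Data.Bool using (Bool; true; false)
open import Data.Fin using (Fin; toℕ; _≟_)
open import Data.Fin.Subset using (Subset; _∈_; _∉_; _∪_; ∣_∣; ⊤)
open import Data.Vec using (tabulate)
open import Data.Product using (Σ; ∃; _×_; _,_)
open import Data.Sum using (_⊎_)
open import Relation.Nullary using (¬_)
open import Relation.Nullary.Decidable using (⌊_⌋)
open import Relation.Binary.PropositionalEquality using (_≡_; _≢_)
open import Function.Bundles using (_↔_; Inverse; _⇔_)

record Graph (n : ℕ) : Set where
  field
    adj    : Fin n → Fin n → Bool
    sym    : ∀ u v → adj u v ≡ adj v u
    irrefl : ∀ v → adj v v ≡ false
open Graph public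

module _ {n : ℕ} (G : Graph n) where

  data PathIn (S : Subset n) : Fin n → Fin n → Set where
    here : ∀ {u} → u ∈ S → PathIn S u u
    step : ∀ {u w v} → u ∈ S → adj G u w ≡ true → PathIn S w v → PathIn S u v

  InducedConnected : Subset n → Set
  InducedConnected S = ∀ u v → u ∈ S → v ∈ S → PathIn S u v

  IsConnectedGraph : Set
  IsConnectedGraph = InducedConnected ⊤

  degree : Fin n → ℕ
  degree v = ∣ tabulate (adj G v) ∣

  Subcubic : Set
  Subcubic = IsConnectedGraph × (∀ v → degree v ≤ 3)

  Dominating : Subset n → Set
  Dominating D = ∀ v → v ∉ D → ∃ λ u → u ∈ D × adj G v u ≡ true

  IsCDS : Subset n → Set
  IsCDS D = Dominating D × InducedConnected D

  Disjoint : Subset n → Subset n → Set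
  Disjoint A B = ∀ x → x ∈ A → x ∉ B

  ConnectedCoalition : Subset n → Subset n → Set
  ConnectedCoalition A B =
    Disjoint A B × ¬ IsCDS A × ¬ IsCDS B × IsCDS (A ∪ B)

  -- A partition of V into k (nonempty) sets V_0..V_{k-1}, given by the
  -- class map; surjectivity = every set of the partition is nonempty.
  record Partition (k : ℕ) : Set where
    field
      cls  : Fin n → Fin k
      surj : ∀ i → ∃ λ v → cls v ≡ i

    part : Fin k → Subset n
    part i = tabulate (λ v → ⌊ cls v ≟ i ⌋)
  open Partition public

  IsCCPartition : ∀ {k} → Partition k → Set
  IsCCPartition {k} π = ∀ i →
      (IsCDS (part π i) × ∣ part π i ∣ ≡ 1)
    ⊎ (∃ λ j → ConnectedCoalition (part π i) (part π j))

  CCNumberIs : ℕ → Set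
  CCNumberIs k =
    (Σ (Partition k) IsCCPartition)
    × (∀ m (π : Partition m) → IsCCPartition π → m ≤ k)

  CCGAdj : ∀ {k} → Partition k → Fin k → Fin k → Set
  CCGAdj π i j = ConnectedCoalition (part π i) (part π j)

StarAdj : ∀ {k} → Fin k → Fin k → Set
StarAdj i j = (toℕ i ≡ 0 × toℕ j ≢ 0) ⊎ (toℕ j ≡ 0 × toℕ i ≢ 0)

Isomorphic : ∀ {k} → (Fin k → Fin k → Set) → (Fin k → Fin k → Set) → Set
Isomorphic {k} R S = Σ (Fin k ↔ Fin k) λ f →
  ∀ i j → R i j ⇔ S (Inverse.to f i) (Inverse.to f j)

bound : ℕ → ℕ
bound n = 6 ⊔ ((n + 7) / 3)

{-# OPTIONS --safe #-}

-- A connected dominating set D of a subcubic graph of order n satisfies n ≤ 2|D| + 2: domination gives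
-- n − |D| ≤ e(D, V ∖ D), connectivity gives at least |D| − 1 edges inside D, and every degree is at most 3.
-- With k ≥ 7 classes, two disjoint coalitions would therefore need more than n vertices, so the coalition
-- graph has no two disjoint edges and is a star; let A be its centre class, which is not a connected
-- dominating set. If A misses a vertex x, every other class meets the closed neighbourhood of x and k ≤ 5.
-- Otherwise G[A] splits into r ≥ 2 unions of components, each joined to every other class by an edge, and
-- counting the degrees in A gives (k − 3) r ≤ |A|; with k − 1 + |A| ≤ n this is 3k ≤ n + 7.
-- Sharpness: two disjoint paths and k − 1 further vertices, each adjacent to one vertex of each path; the
-- paths form one class and every other vertex a class of its own. Orders 6, 8 and 10 are settled by explicit
-- examples whose properties are checked by computation.

module Submission where

open import Defs hiding (sym)
open import Data.Nat.Properties hiding (_≟_; suc-injective)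
open import Algebra.Properties.Semiring.Sum +-*-semiring using (sum; ∑-distrib-+; ∑-comm; sum-cong-≗; *-distribˡ-sum)
open import Algebra.Properties.CommutativeSemigroup +-commutativeSemigroup using (xy∙z≈xz∙y)
open import Data.Bool using (Bool; true; false; not; _∧_; _∨_)
import Data.Bool.Properties as Bool
open import Data.Bool.ListAction using (any)
open import Data.Empty using (⊥)
open import Data.Fin using (Fin; zero; suc; toℕ; fromℕ<; _≟_; _↑ˡ_; _↑ʳ_; splitAt; #_)
open import Data.Fin.Permutation using (transpose)
import Data.Fin.Permutation.Components as Transposition
open import Data.Fin.Properties
  using (all?; any?; ¬∀⟶∃¬; splitAt-↑ˡ; splitAt-↑ʳ; splitAt⁻¹-↑ˡ; splitAt⁻¹-↑ʳ; toℕ<n; toℕ-fromℕ<; fromℕ<-toℕ; suc-injective)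
open import Data.Fin.Subset using (Subset; _∈_; _∉_; _∪_; ∣_∣; ⊤)
open import Data.Fin.Subset.Properties using (_∈?_; ∈⊤; p⊆p∪q; q⊆p∪q; x∈p∪q⁻)
open import Data.List using (List; []; _∷_)
open import Data.Nat using (ℕ; zero; suc; _+_; _*_; _∸_; _≤_; _<_; _⊔_; _⊓_; z≤n; s≤s; _≤?_; _<?_; _≡ᵇ_; _<ᵇ_)
open import Data.Nat.DivMod using (_/_; _divMod_; result; m*n/n≡m; +-distrib-/-∣ʳ; m<n⇒m/n≡0; /-monoˡ-≤)
open import Data.Nat.Divisibility using (divides)
open import Data.Nat.Tactic.RingSolver using (solve-∀)
open import Data.Product using (Σ; ∃; _×_; _,_; proj₁; proj₂)
open import Data.Sum using (_⊎_; inj₁; inj₂)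
open import Data.Vec using (Vec; []; _∷_; lookup; tabulate)
open import Data.Vec.Properties using ([]=⇒lookup; lookup⇒[]=; lookup∘tabulate; lookup-zipWith; zipWith-comm)
open import Effect.Monad using (RawMonad)
open import Function using (_∘_)
open import Function.Bundles using (Inverse; mk⇔)
open import Level using (0ℓ)
open import Relation.Binary.PropositionalEquality
open import Relation.Nullary using (¬_; Dec; yes; no; contradiction)
open import Relation.Nullary.Decidable
  using (⌊_⌋; _×-dec_; _⊎-dec_; _→-dec_; ¬?; map′; from-yes; from-no; decidable-stable; dec-true; ¬¬-excluded-middle)
open import Relation.Nullary.Negation using (¬¬-Monad)

open RawMonad (¬¬-Monad {a = 0ℓ}) using (_>>=_; pure)

private variable
  n k : ℕ

infixr 8 [_]·_
infix 4 _==_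

[_]·_ : Bool → ℕ → ℕ
[ true  ]· m = m
[ false ]· m = 0

𝟙 : Bool → ℕ
𝟙 b = [ b ]· 1

_==_ : Fin n → Fin n → Bool
x == y = ⌊ x ≟ y ⌋

==-refl : (x : Fin n) → (x == x) ≡ true
==-refl x with x ≟ x
... | yes _   = refl
... | no  x≢x = contradiction refl x≢x

==-≢ : {x y : Fin n} → x ≢ y → (x == y) ≡ false
==-≢ {x = x} {y} x≢y with x ≟ y
... | yes x≡y = contradiction x≡y x≢y
... | no  _   = refl

==⇒≡ : {x y : Fin n} → (x == y) ≡ true → x ≡ y
==⇒≡ {x = x} {y} eq with x ≟ y
... | yes x≡y = x≡y

==-sym : (x y : Fin n) → (x == y) ≡ (y == x)
==-sym x y with x ≟ y | y ≟ x
... | yes _   | yes _   = refl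
... | no  _   | no  _   = refl
... | yes x≡y | no  y≢x = contradiction (sym x≡y) y≢x
... | no  x≢y | yes y≡x = contradiction (sym y≡x) x≢y

∧-true : ∀ {b c} → (b ∧ c) ≡ true → b ≡ true × c ≡ true
∧-true {true} c≡true = refl , c≡true

not-true : ∀ {b} → not b ≡ true → b ≡ false
not-true {false} _ = refl

[]·-distrib-+ : ∀ b m k → [ b ]· (m + k) ≡ [ b ]· m + [ b ]· k
[]·-distrib-+ true  m k = refl
[]·-distrib-+ false m k = refl

[]·-comm : ∀ b c m → [ b ]· [ c ]· m ≡ [ c ]· [ b ]· m
[]·-comm true  c     m = refl
[]·-comm false true  m = refl
[]·-comm false false m = refl

[]·-not : ∀ b m → [ b ]· m + [ not b ]· m ≡ m
[]·-not true  m = +-identityʳ m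
[]·-not false m = refl

[]·-∧-split : ∀ c b m → [ c ]· m ≡ [ c ∧ b ]· m + [ c ∧ not b ]· m
[]·-∧-split true  b m = sym ([]·-not b m)
[]·-∧-split false b m = refl

[]·-monoˡ : ∀ {b c} m → (b ≡ true → c ≡ true) → [ b ]· m ≤ [ c ]· m
[]·-monoˡ {true}  m b⇒c rewrite b⇒c refl = ≤-refl
[]·-monoˡ {false} m b⇒c = z≤n

[]·-monoʳ : ∀ b {m k} → m ≤ k → [ b ]· m ≤ [ b ]· k
[]·-monoʳ true  m≤k = m≤k
[]·-monoʳ false m≤k = z≤n

𝟙-∨ : ∀ b c → 𝟙 (b ∨ c) ≤ 𝟙 b + 𝟙 c
𝟙-∨ true  c = s≤s z≤n
𝟙-∨ false c = ≤-refl

sum-mono-≤ : {f g : Fin n → ℕ} → (∀ x → f x ≤ g x) → sum f ≤ sum g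
sum-mono-≤ {zero}  f≤g = z≤n
sum-mono-≤ {suc n} f≤g = +-mono-≤ (f≤g zero) (sum-mono-≤ (f≤g ∘ suc))

sum-const : ∀ c → sum {n} (λ _ → c) ≡ n * c
sum-const {zero}  c = refl
sum-const {suc n} c = cong (c +_) (sum-const {n} c)

sum-zero : sum {n} (λ _ → 0) ≡ 0
sum-zero {n} = trans (sum-const {n} 0) (*-zeroʳ n)

sum-one : sum {n} (λ _ → 1) ≡ n
sum-one {n} = trans (sum-const {n} 1) (*-identityʳ n)

[]·-sum : ∀ b (f : Fin n → ℕ) → [ b ]· sum f ≡ sum (λ x → [ b ]· f x)
[]·-sum true      f = refl
[]·-sum {n} false f = sym (sum-zero {n})

term≤sum : (f : Fin n → ℕ) (t : Fin n) → f t ≤ sum f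
term≤sum f zero    = m≤m+n _ _
term≤sum f (suc t) = ≤-trans (term≤sum (f ∘ suc) t) (m≤n+m _ _)

sum-δ : (f : Fin n → ℕ) (t : Fin n) → sum (λ x → [ x == t ]· f x) ≡ f t
sum-δ {suc n} f zero = begin
  sum {suc n} (λ x → [ x == zero ]· f x)                               ≡⟨ cong₂ _+_
    (cong ([_]· f zero) (==-refl {suc n} zero))
    (sum-cong-≗ (λ x → cong ([_]· f (suc x)) (==-≢ {x = suc x} {zero} λ ()))) ⟩
  f zero + sum {n} (λ _ → 0)                                           ≡⟨ cong (f zero +_) (sum-zero {n}) ⟩
  f zero + 0                                                           ≡⟨ +-identityʳ (f zero) ⟩
  f zero                                                               ∎
  where open ≡-Reasoning
sum-δ f (suc t) = trans
  (cong₂ _+_ (cong ([_]· f zero) (==-≢ {x = zero} {suc t} λ ()))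
             (sum-cong-≗ (λ x → cong ([_]· f (suc x)) (suc-== x))))
  (sum-δ (f ∘ suc) t)
  where
  suc-== : ∀ x → (suc x == suc t) ≡ (x == t)
  suc-== x with x ≟ t
  ... | yes refl = refl
  ... | no  _    = refl

sum-restrict : ∀ (S : Fin n → Bool) f →
               sum (λ x → [ S x ]· f x) + sum (λ x → [ not (S x) ]· f x) ≡ sum f
sum-restrict S f = trans (sym (∑-distrib-+ (λ x → [ S x ]· f x) _)) (sum-cong-≗ (λ x → []·-not (S x) (f x)))

sum-<-witness : (f g : Fin n → ℕ) → sum f < sum g → ∃ λ x → f x < g x
sum-<-witness {zero}  f g ()
sum-<-witness {suc n} f g f<g with f zero <? g zero
... | yes f₀<g₀ = zero , f₀<g₀
... | no  f₀≮g₀ with sum-<-witness (f ∘ suc) (g ∘ suc)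
        (+-cancelˡ-< (g zero) _ _ (≤-<-trans (+-monoˡ-≤ _ (≮⇒≥ f₀≮g₀)) f<g))
...   | x , fx<gx = suc x , fx<gx

fresh : 3 < n → (x y w : Fin n) → ∃ λ z → z ≢ x × z ≢ y × z ≢ w
fresh {n} 3<n x y w
  with sum-<-witness (λ z → 𝟙 (z == x) + 𝟙 (z == y) + 𝟙 (z == w)) (λ _ → 1)
         (subst₂ _<_ (sym three) (sym (sum-one {n})) 3<n)
  where
  three : sum (λ z → 𝟙 (z == x) + 𝟙 (z == y) + 𝟙 (z == w)) ≡ 3
  three = trans (∑-distrib-+ (λ z → 𝟙 (z == x) + 𝟙 (z == y)) _)
                (cong₂ _+_ (trans (∑-distrib-+ (λ z → 𝟙 (z == x)) _) (cong₂ _+_ (sum-δ _ x) (sum-δ _ y)))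
                           (sum-δ _ w))
... | z , hit<1 with z == x in z=x | z == y in z=y | z == w in z=w
...   | false | false | false = z , ≢-from z=x , ≢-from z=y , ≢-from z=w
  where
  ≢-from : ∀ {t} → (z == t) ≡ false → z ≢ t
  ≢-from z≠t refl = contradiction (trans (sym (==-refl z)) z≠t) λ ()
...   | true  | _     | _     = contradiction hit<1 λ { (s≤s ()) }
...   | false | true  | _     = contradiction hit<1 λ { (s≤s ()) }
...   | false | false | true  = contradiction hit<1 λ { (s≤s ()) }

sum-except : ∀ {r} (e : Fin n → ℕ) (c : Fin n) → (∀ l → l ≢ c → r ≤ e l) → n * r + e c ≤ sum e + r
sum-except {n} {r} e c r≤e = begin
  n * r + e c                                  ≡⟨ cong₂ _+_ (sum-const {n} r) (sum-δ (λ _ → e c) c) ⟨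
  sum {n} (λ _ → r) + sum (λ l → [ l == c ]· e c) ≡⟨ ∑-distrib-+ {n} (λ _ → r) _ ⟨
  sum (λ l → r + [ l == c ]· e c)              ≤⟨ sum-mono-≤ pointwise ⟩
  sum (λ l → e l + [ l == c ]· r)              ≡⟨ ∑-distrib-+ e _ ⟩
  sum e + sum (λ l → [ l == c ]· r)            ≡⟨ cong (sum e +_) (sum-δ (λ _ → r) c) ⟩
  sum e + r                                    ∎
  where
  open ≤-Reasoning
  pointwise : ∀ l → r + [ l == c ]· e c ≤ e l + [ l == c ]· r
  pointwise l with l ≟ c
  ... | yes refl = ≤-reflexive (+-comm r (e l))
  ... | no  l≢c  = +-monoˡ-≤ 0 (r≤e l l≢c)

two-terms≤sum : (f : Fin n → ℕ) {a b : Fin n} → a ≢ b → f a + f b ≤ sum f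
two-terms≤sum f {a} {b} a≢b = begin
  f a + f b
    ≡⟨ cong₂ _+_ (sum-δ f a) fb ⟨
  sum (λ x → [ x == a ]· f x) + [ not (b == a) ]· f b
    ≤⟨ +-monoʳ-≤ _ (term≤sum (λ x → [ not (x == a) ]· f x) b) ⟩
  sum (λ x → [ x == a ]· f x) + sum (λ x → [ not (x == a) ]· f x)
    ≡⟨ sum-restrict (_== a) f ⟩
  sum f
    ∎
  where
  open ≤-Reasoning
  fb : [ not (b == a) ]· f b ≡ f b
  fb rewrite ==-≢ (≢-sym a≢b) = refl

four-terms≤sum : (f : Fin n → ℕ) {a b c d : Fin n} → a ≢ b → a ≢ c → a ≢ d → b ≢ c → b ≢ d → c ≢ d →
                 f a + f b + f c + f d ≤ sum f
four-terms≤sum {n} f {a} {b} {c} {d} a≢b a≢c a≢d b≢c b≢d c≢d = begin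
  f a + f b + f c + f d       ≡⟨ +-assoc (f a + f b) (f c) (f d) ⟩
  (f a + f b) + (f c + f d)   ≡⟨ cong₂ _+_ (cong₂ _+_ ga gb) (cong₂ _+_ hc hd) ⟨
  (g a + g b) + (h c + h d)   ≤⟨ +-mono-≤ (two-terms≤sum g a≢b) (two-terms≤sum h c≢d) ⟩
  sum g + sum h               ≡⟨ sum-restrict S f ⟩
  sum f                       ∎
  where
  open ≤-Reasoning
  S : Fin n → Bool
  S x = (x == a) ∨ (x == b)
  g h : Fin n → ℕ
  g x = [ S x ]· f x
  h x = [ not (S x) ]· f x
  ga : g a ≡ f a
  ga rewrite ==-refl a = refl
  gb : g b ≡ f b
  gb rewrite ==-≢ (≢-sym a≢b) | ==-refl b = refl
  hc : h c ≡ f c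
  hc rewrite ==-≢ (≢-sym a≢c) | ==-≢ (≢-sym b≢c) = refl
  hd : h d ≡ f d
  hd rewrite ==-≢ (≢-sym a≢d) | ==-≢ (≢-sym b≢d) = refl

∈⇒lookup : {p : Subset n} {x : Fin n} → x ∈ p → lookup p x ≡ true
∈⇒lookup = []=⇒lookup

lookup⇒∈ : {p : Subset n} {x : Fin n} → lookup p x ≡ true → x ∈ p
lookup⇒∈ {p = p} {x} = lookup⇒[]= x p

lookup-∪ : (p q : Subset n) (x : Fin n) → lookup (p ∪ q) x ≡ (lookup p x ∨ lookup q x)
lookup-∪ p q x = lookup-zipWith _∨_ x p q

true≢false : true ≢ false
true≢false ()

⟪_⟫ : (Fin n → Bool) → Subset n
⟪ X ⟫ = tabulate X

∈⟪⟫⇒ : ∀ {X : Fin n → Bool} {x} → x ∈ ⟪ X ⟫ → X x ≡ true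
∈⟪⟫⇒ {X = X} {x} x∈X = trans (sym (lookup∘tabulate X x)) (∈⇒lookup x∈X)

⇒∈⟪⟫ : ∀ {X : Fin n → Bool} {x} → X x ≡ true → x ∈ ⟪ X ⟫
⇒∈⟪⟫ {X = X} {x} Xx = lookup⇒∈ (trans (lookup∘tabulate X x) Xx)

size : (Fin n → Bool) → ℕ
size S = sum (λ x → 𝟙 (S x))

size-cong : {S T : Fin n → Bool} → (∀ x → S x ≡ T x) → size S ≡ size T
size-cong S≗T = sum-cong-≗ (cong 𝟙 ∘ S≗T)

∣∣≡size : (p : Subset n) → ∣ p ∣ ≡ size (lookup p)
∣∣≡size []          = refl
∣∣≡size (true  ∷ p) = cong suc (∣∣≡size p)
∣∣≡size (false ∷ p) = ∣∣≡size p

size-∨ : (S T : Fin n → Bool) → size (λ x → S x ∨ T x) ≤ size S + size T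
size-∨ S T = ≤-trans (sum-mono-≤ (λ x → 𝟙-∨ (S x) (T x)))
                     (≤-reflexive (∑-distrib-+ (𝟙 ∘ S) (𝟙 ∘ T)))

size-∁ : (S : Fin n → Bool) → size S + size (not ∘ S) ≡ n
size-∁ S = trans (sum-restrict S (λ _ → 1)) sum-one

size-pos : (S : Fin n → Bool) {x : Fin n} → S x ≡ true → 1 ≤ size S
size-pos S {x} Sx = subst (λ b → 𝟙 b ≤ size S) Sx (term≤sum (𝟙 ∘ S) x)

size-⊂ : (S T : Fin n → Bool) {w : Fin n} → (∀ x → T x ≡ true → S x ≡ true) →
         T w ≡ false → S w ≡ true → size T < size S
size-⊂ S T {w} T⊆S Tw Sw = begin
  suc (size T)                              ≡⟨ +-comm 1 (size T) ⟩
  size T + 1                                ≡⟨ cong (size T +_) (sum-δ (λ _ → 1) w) ⟨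
  size T + sum (λ x → [ x == w ]· 1)        ≡⟨ ∑-distrib-+ (𝟙 ∘ T) _ ⟨
  sum (λ x → 𝟙 (T x) + [ x == w ]· 1)       ≤⟨ sum-mono-≤ pointwise ⟩
  size S                                    ∎
  where
  open ≤-Reasoning
  pointwise : ∀ x → 𝟙 (T x) + [ x == w ]· 1 ≤ 𝟙 (S x)
  pointwise x with x == w in x=w
  ... | true  rewrite ==⇒≡ x=w | Tw | Sw = ≤-refl
  ... | false with T x in Tx
  ...   | true  rewrite T⊆S x Tx = ≤-refl
  ...   | false = z≤n

insert : (Fin n → Bool) → Fin n → Fin n → Bool
insert T t x = T x ∨ (x == t)

[]·-insert : (T : Fin n → Bool) {t : Fin n} → T t ≡ false →
             ∀ y m → [ insert T t y ]· m ≡ [ T y ]· m + [ y == t ]· m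
[]·-insert T {t} Tt y m with y == t in y=t
... | true  rewrite ==⇒≡ y=t | Tt = refl
... | false = trans (cong ([_]· m) (Bool.∨-identityʳ (T y))) (sym (+-identityʳ _))

size-insert : (T : Fin n → Bool) {t : Fin n} → T t ≡ false → size (insert T t) ≡ size T + 1
size-insert T {t} Tt =
  trans (sum-cong-≗ (λ y → []·-insert T Tt y 1))
        (trans (∑-distrib-+ (𝟙 ∘ T) _) (cong (size T +_) (sum-δ (λ _ → 1) t)))

-- Edge counting, paths and connectivity

¬¬-shift-Fin : {P : Fin n → Set} → (∀ x → ¬ ¬ P x) → ¬ ¬ (∀ x → P x)
¬¬-shift-Fin {zero}  _   = pure λ ()
¬¬-shift-Fin {suc n} ¬¬P = do
  P₀ ← ¬¬P zero
  P₊ ← ¬¬-shift-Fin (¬¬P ∘ suc)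
  pure λ { zero → P₀ ; (suc x) → P₊ x }

module _ (G : Graph n) where

  adjℕ : Fin n → Fin n → ℕ
  adjℕ x y = 𝟙 (adj G x y)

  adjℕ-sym : ∀ x y → adjℕ x y ≡ adjℕ y x
  adjℕ-sym x y = cong 𝟙 (Graph.sym G x y)

  deg : Fin n → ℕ
  deg v = sum (adjℕ v)

  degree≡deg : ∀ v → degree G v ≡ deg v
  degree≡deg v = trans (∣∣≡size (tabulate (adj G v))) (size-cong (lookup∘tabulate (adj G v)))

  degIn : (Fin n → Bool) → Fin n → ℕ
  degIn S v = sum (λ y → [ S y ]· adjℕ v y)

  edges : (Fin n → Bool) → (Fin n → Bool) → ℕ
  edges S T = sum (λ x → [ S x ]· degIn T x)

  inner : (Fin n → Bool) → ℕ
  inner S = edges S S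

  degIn-cong : {S T : Fin n → Bool} → (∀ x → S x ≡ T x) → ∀ v → degIn S v ≡ degIn T v
  degIn-cong S≗T v = sum-cong-≗ (λ y → cong ([_]· adjℕ v y) (S≗T y))

  edges-cong : {S T S′ T′ : Fin n → Bool} → (∀ x → S x ≡ S′ x) → (∀ x → T x ≡ T′ x) →
               edges S T ≡ edges S′ T′
  edges-cong S≗S′ T≗T′ = sum-cong-≗ (λ x → cong₂ [_]·_ (S≗S′ x) (degIn-cong T≗T′ x))

  edges-sym : ∀ S T → edges S T ≡ edges T S
  edges-sym S T = begin
    sum (λ x → [ S x ]· sum (λ y → [ T y ]· adjℕ x y))
      ≡⟨ sum-cong-≗ (λ x → []·-sum (S x) (λ y → [ T y ]· adjℕ x y)) ⟩
    sum (λ x → sum (λ y → [ S x ]· [ T y ]· adjℕ x y))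
      ≡⟨ ∑-comm (λ x y → [ S x ]· [ T y ]· adjℕ x y) ⟩
    sum (λ y → sum (λ x → [ S x ]· [ T y ]· adjℕ x y))
      ≡⟨ sum-cong-≗ (λ y → sum-cong-≗ (λ x →
           trans ([]·-comm (S x) (T y) _) (cong ([ T y ]·_ ∘ [ S x ]·_) (adjℕ-sym x y)))) ⟩
    sum (λ y → sum (λ x → [ T y ]· [ S x ]· adjℕ y x))
      ≡⟨ sum-cong-≗ (λ y → []·-sum (T y) (λ x → [ S x ]· adjℕ y x)) ⟨
    sum (λ y → [ T y ]· sum (λ x → [ S x ]· adjℕ y x))
      ∎
    where open ≡-Reasoning

  edges-monoʳ : ∀ X {T T′} → (∀ y → T y ≡ true → T′ y ≡ true) → edges X T ≤ edges X T′
  edges-monoʳ X T⊆T′ = sum-mono-≤ λ x → []·-monoʳ (X x) (sum-mono-≤ λ y → []·-monoˡ _ (T⊆T′ y))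

  degIn-pos : ∀ S {v u} → S u ≡ true → adj G v u ≡ true → 1 ≤ degIn S v
  degIn-pos S {v} {u} Su vu =
    subst (λ m → m ≤ degIn S v) (cong₂ [_]·_ Su (cong 𝟙 vu)) (term≤sum (λ y → [ S y ]· adjℕ v y) u)

  edges-pos : ∀ S T {s t} → S s ≡ true → T t ≡ true → adj G s t ≡ true → 1 ≤ edges S T
  edges-pos S T {s} Ss Tt st = ≤-trans (degIn-pos T Tt st)
    (subst (λ b → [ b ]· degIn T s ≤ edges S T) Ss (term≤sum (λ x → [ S x ]· degIn T x) s))

  inner+boundary : ∀ S → inner S + edges S (not ∘ S) ≡ sum (λ x → [ S x ]· deg x)
  inner+boundary S = trans (sym (∑-distrib-+ (λ x → [ S x ]· degIn S x) _)) (sum-cong-≗ λ x →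
    trans (sym ([]·-distrib-+ (S x) _ _)) (cong ([ S x ]·_) (sum-restrict S (adjℕ x))))

  inner-insert : ∀ T {t} → T t ≡ false → inner (insert T t) ≡ inner T + degIn T t + degIn T t
  inner-insert T {t} Tt = begin
    inner (insert T t)
      ≡⟨ sum-cong-≗ (λ x → trans (cong ([ insert T t x ]·_) (degIn-insert x)) ([]·-insert T Tt x _)) ⟩
    sum (λ x → [ T x ]· (degIn T x + adjℕ x t) + [ x == t ]· (degIn T x + adjℕ x t))
      ≡⟨ trans (∑-distrib-+ (λ x → [ T x ]· (degIn T x + adjℕ x t)) _)
               (cong (sum (λ x → [ T x ]· (degIn T x + adjℕ x t)) +_)
                     (sum-δ (λ x → degIn T x + adjℕ x t) t)) ⟩
    sum (λ x → [ T x ]· (degIn T x + adjℕ x t)) + (degIn T t + adjℕ t t)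
      ≡⟨ cong₂ _+_ (sum-cong-≗ (λ x → []·-distrib-+ (T x) _ _))
                   (cong (λ m → degIn T t + 𝟙 m) (irrefl G t)) ⟩
    sum (λ x → [ T x ]· degIn T x + [ T x ]· adjℕ x t) + (degIn T t + 0)
      ≡⟨ cong₂ _+_ (∑-distrib-+ (λ x → [ T x ]· degIn T x) _) (+-identityʳ _) ⟩
    inner T + sum (λ x → [ T x ]· adjℕ x t) + degIn T t
      ≡⟨ cong (λ m → inner T + m + degIn T t) (sum-cong-≗ λ x → cong ([ T x ]·_) (adjℕ-sym x t)) ⟩
    inner T + degIn T t + degIn T t
      ∎
    where
    open ≡-Reasoning
    degIn-insert : ∀ x → degIn (insert T t) x ≡ degIn T x + adjℕ x t
    degIn-insert x = trans (sum-cong-≗ (λ y → []·-insert T Tt y (adjℕ x y)))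
                           (trans (∑-distrib-+ (λ y → [ T y ]· adjℕ x y) _)
                                  (cong (degIn T x +_) (sum-δ (adjℕ x) t)))

  inner-insert-≥ : ∀ T {s t} → T s ≡ true → T t ≡ false → adj G t s ≡ true →
                   inner T + 2 ≤ inner (insert T t)
  inner-insert-≥ T Ts Tt ts = begin
    inner T + 2                       ≤⟨ +-monoʳ-≤ (inner T) (+-mono-≤ (degIn-pos T Ts ts) (degIn-pos T Ts ts)) ⟩
    inner T + (degIn T _ + degIn T _) ≡⟨ +-assoc (inner T) _ _ ⟨
    inner T + degIn T _ + degIn T _   ≡⟨ inner-insert T Tt ⟨
    inner (insert T _)                ∎
    where open ≤-Reasoning

  path-start : ∀ {p u v} → PathIn G p u v → u ∈ p
  path-start (here u∈p)     = u∈p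
  path-start (step u∈p _ _) = u∈p

  path-snoc : ∀ {p u x w} → PathIn G p u x → adj G x w ≡ true → w ∈ p → PathIn G p u w
  path-snoc (here x∈p)         xw w∈p = step x∈p xw (here w∈p)
  path-snoc (step u∈p uy path) xw w∈p = step u∈p uy (path-snoc path xw w∈p)

  path-++ : ∀ {p u x w} → PathIn G p u x → PathIn G p x w → PathIn G p u w
  path-++ (here _)           path′ = path′
  path-++ (step u∈p uy path) path′ = step u∈p uy (path-++ path path′)

  path-reverse : ∀ {p u v} → PathIn G p u v → PathIn G p v u
  path-reverse (here u∈p)         = here u∈p
  path-reverse (step u∈p uy path) = path-snoc (path-reverse path) (trans (Graph.sym G _ _) uy) u∈p

  path-closed : ∀ {p u v} (X : Fin n → Bool) →
                (∀ x y → X x ≡ true → y ∈ p → adj G x y ≡ true → X y ≡ true) →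
                PathIn G p u v → X u ≡ true → X v ≡ true
  path-closed X closed (here _)          Xu = Xu
  path-closed X closed (step _ uw path) Xu = path-closed X closed path (closed _ _ Xu (path-start path) uw)

  path-exit : ∀ {p u v} (X : Fin n → Bool) → PathIn G p u v → X u ≡ true → X v ≡ false →
              ∃ λ s → ∃ λ t → X s ≡ true × t ∈ p × X t ≡ false × adj G s t ≡ true
  path-exit X (here _) Xu Xv = contradiction (trans (sym Xu) Xv) true≢false
  path-exit X (step {w = w} _ uw path) Xu Xv with X w in Xw
  ... | true  = path-exit X path Xw Xv
  ... | false = _ , w , Xu , path-start path , Xw , uw

  -- Reachability in G[X] is not decided constructively; every statement derived from this case split
  -- ends in a decidable inequality, so excluded middle is available under a double negation.
  data Connectivity (X : Fin n → Bool) : Set where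
    connected : InducedConnected G ⟪ X ⟫ → Connectivity X
    split     : ∀ {u v} → X u ≡ true → X v ≡ true → ¬ PathIn G ⟪ X ⟫ u v →
                (∀ w → Dec (PathIn G ⟪ X ⟫ u w)) → Connectivity X

  ¬¬-connectivity : ∀ X → ¬ ¬ Connectivity X
  ¬¬-connectivity X = do
    path? ← ¬¬-shift-Fin λ u → ¬¬-shift-Fin λ w → ¬¬-excluded-middle
    disconnected? ← ¬¬-excluded-middle
    pure (decide path? disconnected?)
    where
    Disconnected = ∃ λ u → ∃ λ v → X u ≡ true × X v ≡ true × ¬ PathIn G ⟪ X ⟫ u v
    decide : (∀ u w → Dec (PathIn G ⟪ X ⟫ u w)) → Dec Disconnected → Connectivity X
    decide path? (yes (u , v , Xu , Xv , u↛v)) = split Xu Xv u↛v (path? u)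
    decide path? (no connected′) = connected λ u v u∈X v∈X → path u∈X v∈X (path? u v)
      where
      path : ∀ {u v} → u ∈ ⟪ X ⟫ → v ∈ ⟪ X ⟫ → Dec (PathIn G ⟪ X ⟫ u v) → PathIn G ⟪ X ⟫ u v
      path _   _   (yes u→v) = u→v
      path u∈X v∈X (no  u↛v) = contradiction (_ , _ , ∈⟪⟫⇒ u∈X , ∈⟪⟫⇒ v∈X , u↛v) connected′

  rooted-tree⇒connected : ∀ (p : Subset n) {r} (parent : Fin n → Fin n) (depth : Fin n → ℕ) → r ∈ p →
    (∀ w → w ∈ p → w ≡ r ⊎ parent w ∈ p × adj G w (parent w) ≡ true × depth (parent w) < depth w) →
    InducedConnected G p
  rooted-tree⇒connected p {r} parent depth r∈p tree u v u∈p v∈p =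
    path-++ (to-root (suc (depth u)) ≤-refl u∈p) (path-reverse (to-root (suc (depth v)) ≤-refl v∈p))
    where
    to-root : ∀ fuel {w} → depth w < fuel → w ∈ p → PathIn G p w r
    to-root (suc fuel) {w} w<fuel w∈p with tree w w∈p
    ... | inj₁ refl = here w∈p
    ... | inj₂ (pw∈p , w-pw , pw<w) = step w∈p w-pw (to-root fuel (≤-trans pw<w (≤-pred w<fuel)) pw∈p)

  -- Grow T inside p one vertex at a time; a vertex joined to T by an edge raises inner by at least two.
  connected-grow : ∀ (p : Subset n) → InducedConnected G p → ∀ fuel (T : Fin n → Bool) {t₀} →
                   T t₀ ≡ true → (∀ x → T x ≡ true → lookup p x ≡ true) → size (lookup p) ≤ fuel + size T →
                   inner T + 2 * size (lookup p) ≤ inner (lookup p) + 2 * size T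
  connected-grow p conn fuel T {t₀} Tt₀ T⊆p fuel-ok
    with any? (λ w → (lookup p w ∧ not (T w)) Bool.≟ true)
  ... | no T⊇p = ≤-reflexive (cong₂ _+_ (edges-cong T≗p T≗p) (cong (2 *_) (size-cong (sym ∘ T≗p))))
    where
    T≗p : ∀ x → T x ≡ lookup p x
    T≗p x with T x in Tx | lookup p x in px
    ... | true  | _     = trans (sym (T⊆p x Tx)) px
    ... | false | false = refl
    ... | false | true  = contradiction (x , trans (cong₂ (λ b c → b ∧ not c) px Tx) refl) T⊇p
  ... | yes (w , pw∖Tw) with ∧-true pw∖Tw
  ...   | pw , ¬Tw
    with path-exit T (conn t₀ w (lookup⇒∈ (T⊆p t₀ Tt₀)) (lookup⇒∈ pw)) Tt₀ (not-true ¬Tw)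
  ...     | s , t , Ts , t∈p , Tt , st = extend fuel fuel-ok
    where
    T⁺ = insert T t
    T⁺⊆p : ∀ x → T⁺ x ≡ true → lookup p x ≡ true
    T⁺⊆p x T⁺x with T x in Tx | x == t in x=t
    ... | true  | _    = T⊆p x Tx
    ... | false | true rewrite ==⇒≡ x=t = ∈⇒lookup t∈p
    extend : ∀ f → size (lookup p) ≤ f + size T →
             inner T + 2 * size (lookup p) ≤ inner (lookup p) + 2 * size T
    extend zero    p≤T = contradiction p≤T (<⇒≱ (size-⊂ (lookup p) T T⊆p (not-true ¬Tw) pw))
    extend (suc f) p≤f+T = +-cancelʳ-≤ 2 _ _ (begin
      inner T + 2 * size (lookup p) + 2    ≡⟨ xy∙z≈xz∙y (inner T) _ 2 ⟩
      inner T + 2 + 2 * size (lookup p)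
        ≤⟨ +-monoˡ-≤ _ (inner-insert-≥ T Ts Tt (trans (Graph.sym G t s) st)) ⟩
      inner T⁺ + 2 * size (lookup p)
        ≤⟨ connected-grow p conn f T⁺ (cong (_∨ (t₀ == t)) Tt₀) T⁺⊆p p≤f+T⁺ ⟩
      inner (lookup p) + 2 * size T⁺       ≡⟨ cong (λ m → inner (lookup p) + 2 * m) (size-insert T Tt) ⟩
      inner (lookup p) + 2 * (size T + 1)  ≡⟨ cong (inner (lookup p) +_) (*-distribˡ-+ 2 (size T) 1) ⟩
      inner (lookup p) + (2 * size T + 2)  ≡⟨ +-assoc (inner (lookup p)) _ 2 ⟨
      inner (lookup p) + 2 * size T + 2    ∎)
      where
      open ≤-Reasoning
      p≤f+T⁺ : size (lookup p) ≤ f + size T⁺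
      p≤f+T⁺ = ≤-trans p≤f+T (≤-reflexive (trans (sym (+-suc f (size T)))
                 (cong (f +_) (trans (+-comm 1 (size T)) (sym (size-insert T Tt))))))

  connected-bound : ∀ (p : Subset n) → InducedConnected G p → ∀ {s₀} → s₀ ∈ p →
                    2 * size (lookup p) ≤ inner (lookup p) + 2
  connected-bound p conn {s₀} s₀∈p = subst₂ _≤_
    (cong (_+ 2 * size (lookup p)) inner-single)
    (cong (λ m → inner (lookup p) + 2 * m) (sum-δ (λ _ → 1) s₀))
    (connected-grow p conn (size (lookup p)) (_== s₀) (==-refl s₀) single⊆p (m≤m+n _ _))
    where
    single⊆p : ∀ x → (x == s₀) ≡ true → lookup p x ≡ true
    single⊆p x x=s₀ rewrite ==⇒≡ x=s₀ = ∈⇒lookup s₀∈p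
    inner-single : inner (_== s₀) ≡ 0
    inner-single = trans (sum-δ (degIn (_== s₀)) s₀)
                         (trans (sum-δ (adjℕ s₀) s₀) (cong 𝟙 (irrefl G s₀)))

  Dominated : Subset n → Fin n → Set
  Dominated p x = x ∈ p ⊎ ∃ λ u → u ∈ p × adj G x u ≡ true

  dominated? : ∀ p x → Dec (Dominated p x)
  dominated? p x = (x ∈? p) ⊎-dec any? (λ u → (u ∈? p) ×-dec (adj G x u Bool.≟ true))

  dominated⇒dominating : ∀ p → (∀ v → Dominated p v) → Dominating G p
  dominated⇒dominating p all-dominated v v∉p with all-dominated v
  ... | inj₁ v∈p  = contradiction v∈p v∉p
  ... | inj₂ u,vu = u,vu

  dominating⇒dominated : ∀ p → Dominating G p → ∀ v → Dominated p v
  dominating⇒dominated p dom v with v ∈? p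
  ... | yes v∈p = inj₁ v∈p
  ... | no  v∉p = inj₂ (dom v v∉p)

  dominating? : ∀ p → Dec (Dominating G p)
  dominating? p = map′ (dominated⇒dominating p) (dominating⇒dominated p) (all? (dominated? p))

  dominating-or-undominated : ∀ (p : Subset n) →
    Dominating G p ⊎ ∃ λ x → x ∉ p × ∀ u → u ∈ p → adj G x u ≡ false
  dominating-or-undominated p with dominating? p
  ... | yes dom  = inj₁ dom
  ... | no  ¬dom with ¬∀⟶∃¬ n (Dominated p) (dominated? p) (¬dom ∘ dominated⇒dominating p)
  ...   | x , x-undominated = inj₂ (x , x-undominated ∘ inj₁ , no-edge)
    where
    no-edge : ∀ u → u ∈ p → adj G x u ≡ false
    no-edge u u∈p with adj G x u in xu
    ... | true  = contradiction (inj₂ (u , u∈p , xu)) x-undominated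
    ... | false = refl

  size-∁≤edges : ∀ (p : Subset n) → Dominating G p →
                 size (not ∘ lookup p) ≤ edges (not ∘ lookup p) (lookup p)
  size-∁≤edges p dom = sum-mono-≤ pointwise
    where
    pointwise : ∀ x → 𝟙 (not (lookup p x)) ≤ [ not (lookup p x) ]· degIn (lookup p) x
    pointwise x with lookup p x in px
    ... | true  = z≤n
    ... | false with dom x (λ x∈p → true≢false (trans (sym (∈⇒lookup x∈p)) px))
    ...   | u , u∈p , xu = degIn-pos (lookup p) (∈⇒lookup u∈p) xu

  module _ (subcubic : ∀ v → degree G v ≤ 3) where

    sum-deg≤ : ∀ S → sum (λ x → [ S x ]· deg x) ≤ 3 * size S
    sum-deg≤ S = ≤-trans (sum-mono-≤ λ x → pointwise (S x) x)
                         (≤-reflexive (sym (*-distribˡ-sum 3 (𝟙 ∘ S))))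
      where
      pointwise : ∀ b x → [ b ]· deg x ≤ 3 * 𝟙 b
      pointwise true  x = subst (_≤ 3) (degree≡deg x) (subcubic x)
      pointwise false x = z≤n

    inner+boundary≤ : ∀ S → inner S + edges S (not ∘ S) ≤ 3 * size S
    inner+boundary≤ S = subst (_≤ 3 * size S) (sym (inner+boundary S)) (sum-deg≤ S)

    dominating-bound : ∀ (p : Subset n) → Dominating G p → n + inner (lookup p) ≤ 4 * size (lookup p)
    dominating-bound p dom = begin
      n + inner S                            ≡⟨ cong (_+ inner S) (size-∁ S) ⟨
      size S + size (not ∘ S) + inner S      ≤⟨ +-monoˡ-≤ (inner S) (+-monoʳ-≤ (size S) (size-∁≤edges p dom)) ⟩
      size S + edges (not ∘ S) S + inner S   ≡⟨ cong (λ e → size S + e + inner S) (edges-sym (not ∘ S) S) ⟩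
      size S + edges S (not ∘ S) + inner S   ≡⟨ +-assoc (size S) _ _ ⟩
      size S + (edges S (not ∘ S) + inner S) ≡⟨ cong (size S +_) (+-comm _ (inner S)) ⟩
      size S + (inner S + edges S (not ∘ S)) ≤⟨ +-monoʳ-≤ (size S) (inner+boundary≤ S) ⟩
      size S + 3 * size S                    ∎
      where
      open ≤-Reasoning
      S = lookup p

    cds-bound : ∀ (p : Subset n) → IsCDS G p → ∀ {x} → x ∈ p → n ≤ 2 * size (lookup p) + 2
    cds-bound p (dom , conn) x∈p = +-cancelʳ-≤ (2 * s) n (2 * s + 2) (begin
      n + 2 * s           ≤⟨ +-monoʳ-≤ n (connected-bound p conn x∈p) ⟩
      n + (inner S + 2)   ≡⟨ +-assoc n (inner S) 2 ⟨
      n + inner S + 2     ≤⟨ +-monoˡ-≤ 2 (dominating-bound p dom) ⟩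
      4 * s + 2           ≡⟨ regroup s ⟩
      2 * s + 2 + 2 * s   ∎)
      where
      open ≤-Reasoning
      S = lookup p
      s = size S
      regroup : ∀ s → 4 * s + 2 ≡ 2 * s + 2 + 2 * s
      regroup = solve-∀

-- Stars

module _ (R : Fin k → Fin k → Set) where

  NoDisjointEdges : Set
  NoDisjointEdges = ∀ {a b c d} → R a b → R c d → a ≢ c → a ≢ d → b ≢ c → b ≢ d → ⊥

  IsStar : Fin k → Set
  IsStar c = (∀ l → l ≢ c → R c l) × (∀ {x y} → R x y → x ≡ c ⊎ y ≡ c)

  -- Take an edge uv and a vertex w off it; the partner c of w lies on uv, and c meets every edge.
  star-centre : 3 < k → (∀ {i j} → R i j → R j i) → (∀ i → ∃ (R i)) → NoDisjointEdges → ∃ IsStar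
  star-centre 3<k R-sym partner disjoint with fromℕ< {m = 0} (≤-trans (s≤s z≤n) 3<k)
  ... | u with partner u
  ...   | v , uv with fresh 3<k u v v
  ...     | w , w≢u , w≢v , _ with partner w in partner-w
  ...       | c , wc = c , spoke , hub
    where
    p : Fin k → Fin k
    p i = proj₁ (partner i)

    meets-uv : ∀ {l q} → R l q → l ≢ u → l ≢ v → q ≡ u ⊎ q ≡ v
    meets-uv {l} {q} lq l≢u l≢v with q ≟ u | q ≟ v
    ... | yes q≡u | _       = inj₁ q≡u
    ... | no  _   | yes q≡v = inj₂ q≡v
    ... | no  q≢u | no  q≢v = contradiction (disjoint lq uv l≢u l≢v q≢u q≢v) λ ()

    c∈uv : c ≡ u ⊎ c ≡ v
    c∈uv = meets-uv wc w≢u w≢v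

    ∉uv : ∀ {x y} → x ≡ u ⊎ x ≡ v → y ≢ u → y ≢ v → x ≢ y
    ∉uv (inj₁ x≡u) y≢u _ x≡y = y≢u (trans (sym x≡y) x≡u)
    ∉uv (inj₂ x≡v) _ y≢v x≡y = y≢v (trans (sym x≡y) x≡v)

    partner-c : ∀ l → l ≢ u → l ≢ v → p l ≡ c
    partner-c l l≢u l≢v with p l ≟ c
    ... | yes pl≡c = pl≡c
    ... | no  pl≢c = contradiction
      (disjoint (proj₂ (partner l)) wc
        (λ l≡w → pl≢c (trans (cong p l≡w) (cong proj₁ partner-w)))
        (λ l≡c → ∉uv c∈uv l≢u l≢v (sym l≡c))
        (λ pl≡w → ∉uv (meets-uv (proj₂ (partner l)) l≢u l≢v) w≢u w≢v pl≡w)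
        pl≢c)
      λ ()

    spoke : ∀ l → l ≢ c → R c l
    spoke l l≢c with l ≟ u | l ≟ v | c∈uv
    ... | yes l≡u | _       | inj₁ c≡u = contradiction (trans l≡u (sym c≡u)) l≢c
    ... | yes l≡u | _       | inj₂ c≡v = subst₂ R (sym c≡v) (sym l≡u) (R-sym uv)
    ... | no  _   | yes l≡v | inj₁ c≡u = subst₂ R (sym c≡u) (sym l≡v) uv
    ... | no  _   | yes l≡v | inj₂ c≡v = contradiction (trans l≡v (sym c≡v)) l≢c
    ... | no  l≢u | no  l≢v | _        = R-sym (subst (R l) (partner-c l l≢u l≢v) (proj₂ (partner l)))

    hub : ∀ {x y} → R x y → x ≡ c ⊎ y ≡ c
    hub {x} {y} xy with x ≟ c | y ≟ c
    ... | yes x≡c | _       = inj₁ x≡c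
    ... | no  _   | yes y≡c = inj₂ y≡c
    ... | no  x≢c | no  y≢c with fresh 3<k x y c
    ...   | z , z≢x , z≢y , z≢c =
      contradiction (disjoint xy (spoke z z≢c) x≢c (≢-sym z≢x) y≢c (≢-sym z≢y)) λ ()

transpose-self : (i j : Fin k) → Transposition.transpose i j i ≡ j
transpose-self i j rewrite dec-true (i ≟ i) refl = refl

toℕ≡0 : {i : Fin (suc k)} → toℕ i ≡ 0 → i ≡ zero
toℕ≡0 {i = zero} _ = refl

star-isomorphic : {R : Fin k → Fin k → Set} (c : Fin k) → (∀ {i j} → R i j → i ≢ j) →
                  (∀ {i j} → R i j → R j i) → IsStar R c → Isomorphic R StarAdj
star-isomorphic {suc k} {R} c R-irrefl R-sym (spoke , hub) = σ , λ i j → mk⇔ (to i j) (from i j)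
  where
  σ = transpose c zero
  open Inverse σ using () renaming (to to σ→)

  σ≡0⇒c : ∀ {i} → toℕ (σ→ i) ≡ 0 → i ≡ c
  σ≡0⇒c {i} σi≡0 = begin
    i                                           ≡⟨ Inverse.strictlyInverseʳ σ i ⟨
    Transposition.transpose zero c (σ→ i)       ≡⟨ cong (Transposition.transpose zero c) (toℕ≡0 σi≡0) ⟩
    Transposition.transpose zero c zero         ≡⟨ transpose-self zero c ⟩
    c                                           ∎
    where open ≡-Reasoning

  c⇒σ≡0 : ∀ {i} → i ≡ c → toℕ (σ→ i) ≡ 0
  c⇒σ≡0 refl = cong toℕ (transpose-self c zero)

  to : ∀ i j → R i j → StarAdj (σ→ i) (σ→ j)
  to i j ij with hub ij
  ... | inj₁ i≡c = inj₁ (c⇒σ≡0 i≡c , λ σj≡0 → R-irrefl ij (trans i≡c (sym (σ≡0⇒c σj≡0))))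
  ... | inj₂ j≡c = inj₂ (c⇒σ≡0 j≡c , λ σi≡0 → R-irrefl ij (trans (σ≡0⇒c σi≡0) (sym j≡c)))

  from : ∀ i j → StarAdj (σ→ i) (σ→ j) → R i j
  from i j (inj₁ (σi≡0 , σj≢0)) with refl ← σ≡0⇒c {i} σi≡0 = spoke j (σj≢0 ∘ c⇒σ≡0)
  from i j (inj₂ (σj≡0 , σi≢0)) with refl ← σ≡0⇒c {j} σj≡0 = R-sym (spoke i (σi≢0 ∘ c⇒σ≡0))

-- Connected coalition partitions

two-cds-arithmetic : ∀ {n k a b c d} → a + b + c + d + k ≤ n + 4 →
                     n ≤ 2 * (a + b) + 2 → n ≤ 2 * (c + d) + 2 → k ≤ 6
two-cds-arithmetic {n} {k} {a} {b} {c} {d} count cds₁ cds₂ =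
  *-cancelˡ-≤ 2 (+-cancelʳ-≤ (2 * (a + b + c + d)) _ _ (begin
  2 * k + 2 * (a + b + c + d)                           ≡⟨ double a b c d k ⟩
  (a + b + c + d + k) + (a + b + c + d + k)             ≤⟨ +-mono-≤ count count ⟩
  (n + 4) + (n + 4)                                     ≡⟨ regroup n ⟩
  n + n + 8                                             ≤⟨ +-monoˡ-≤ 8 (+-mono-≤ cds₁ cds₂) ⟩
  (2 * (a + b) + 2) + (2 * (c + d) + 2) + 8             ≡⟨ collect a b c d ⟩
  2 * 6 + 2 * (a + b + c + d)                           ∎))
  where
  open ≤-Reasoning
  double : ∀ a b c d k → 2 * k + 2 * (a + b + c + d) ≡ (a + b + c + d + k) + (a + b + c + d + k)
  double = solve-∀
  regroup : ∀ n → (n + 4) + (n + 4) ≡ n + n + 8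
  regroup = solve-∀
  collect : ∀ a b c d → (2 * (a + b) + 2) + (2 * (c + d) + 2) + 8 ≡ 2 * 6 + 2 * (a + b + c + d)
  collect = solve-∀

module _ {n} (G : Graph n) {k} (π : Partition G k) where

  class : Fin k → Fin n → Bool
  class i v = cls π v == i

  lookup-part : ∀ i v → lookup (part π i) v ≡ class i v
  lookup-part i v = lookup∘tabulate (λ w → cls π w == i) v

  ∈-part⇒ : ∀ {i v} → v ∈ part π i → class i v ≡ true
  ∈-part⇒ {i} {v} v∈i = trans (sym (lookup-part i v)) (∈⇒lookup v∈i)

  ⇒∈-part : ∀ {i v} → class i v ≡ true → v ∈ part π i
  ⇒∈-part {i} {v} v∈i = lookup⇒∈ (trans (lookup-part i v) v∈i)

  lookup-part-∪ : ∀ i j v → lookup (part π i ∪ part π j) v ≡ (class i v ∨ class j v)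
  lookup-part-∪ i j v = trans (lookup-∪ (part π i) (part π j) v)
                              (cong₂ _∨_ (lookup-part i v) (lookup-part j v))

  representative : ∀ i → ∃ λ v → class i v ≡ true
  representative i = proj₁ (surj π i) , trans (cong (_== i) (proj₂ (surj π i))) (==-refl i)

  classSize : Fin k → ℕ
  classSize i = size (class i)

  classSize-pos : ∀ i → 1 ≤ classSize i
  classSize-pos i = size-pos (class i) (proj₂ (representative i))

  sum-partition : (f : Fin n → ℕ) → sum (λ i → sum (λ v → [ class i v ]· f v)) ≡ sum f
  sum-partition f = trans (∑-comm (λ i v → [ class i v ]· f v)) (sum-cong-≗ λ v →
    trans (sum-cong-≗ (λ i → cong ([_]· f v) (==-sym (cls π v) i))) (sum-δ (λ _ → f v) (cls π v)))

  sum-classSize : sum classSize ≡ n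
  sum-classSize = trans (sum-partition (λ _ → 1)) sum-one

  classes≤vertices : k ≤ n
  classes≤vertices = subst₂ _≤_ (sum-one {k}) sum-classSize (sum-mono-≤ classSize-pos)

  sum-edges-classes : ∀ S → sum (λ l → edges G S (class l)) ≡ sum (λ x → [ S x ]· deg G x)
  sum-edges-classes S = begin
    sum (λ l → sum (λ x → [ S x ]· degIn G (class l) x))
      ≡⟨ ∑-comm (λ l x → [ S x ]· degIn G (class l) x) ⟩
    sum (λ x → sum (λ l → [ S x ]· degIn G (class l) x))
      ≡⟨ sum-cong-≗ (λ x → []·-sum (S x) (λ l → degIn G (class l) x)) ⟨
    sum (λ x → [ S x ]· sum (λ l → degIn G (class l) x))
      ≡⟨ sum-cong-≗ (λ x → cong ([ S x ]·_) (sum-partition (adjℕ G x))) ⟩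
    sum (λ x → [ S x ]· deg G x)
      ∎
    where open ≡-Reasoning

  classes-meeting-bound : ∀ (N : Fin n → Bool) c →
                          (∀ l → l ≢ c → ∃ λ v → class l v ≡ true × N v ≡ true) → k ≤ size N + 1
  classes-meeting-bound N c meets = begin
    k                  ≡⟨ *-identityʳ k ⟨
    k * 1              ≤⟨ m≤m+n (k * 1) (e c) ⟩
    k * 1 + e c        ≤⟨ sum-except e c e≥1 ⟩
    sum e + 1          ≡⟨ cong (_+ 1) (sum-partition (𝟙 ∘ N)) ⟩
    size N + 1         ∎
    where
    open ≤-Reasoning
    e : Fin k → ℕ
    e l = sum (λ v → [ class l v ]· 𝟙 (N v))
    e≥1 : ∀ l → l ≢ c → 1 ≤ e l
    e≥1 l l≢c with meets l l≢c
    ... | v , lv , Nv = subst (_≤ e l) (cong₂ (λ b b′ → [ b ]· 𝟙 b′) lv Nv)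
                              (term≤sum (λ v → [ class l v ]· 𝟙 (N v)) v)

  classes-disjoint : ∀ {i j} → i ≢ j → Disjoint G (part π i) (part π j)
  classes-disjoint i≢j x x∈i x∈j = i≢j (trans (sym (==⇒≡ (∈-part⇒ x∈i))) (==⇒≡ (∈-part⇒ x∈j)))

  four-classes-bound : ∀ {a b c d} → a ≢ b → a ≢ c → a ≢ d → b ≢ c → b ≢ d → c ≢ d →
                       classSize a + classSize b + classSize c + classSize d + k ≤ n + 4
  four-classes-bound {a} {b} {c} {d} a≢b a≢c a≢d b≢c b≢d c≢d = begin
    s a + s b + s c + s d + k
      ≡⟨ cong (_+ k) (cong₂ _+_ (cong₂ _+_ (cong₂ _+_ (s≡s′+1 a) (s≡s′+1 b)) (s≡s′+1 c))
                               (s≡s′+1 d)) ⟩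
    (s′ a + 1) + (s′ b + 1) + (s′ c + 1) + (s′ d + 1) + k
      ≡⟨ shift (s′ a) (s′ b) (s′ c) (s′ d) k ⟩
    s′ a + s′ b + s′ c + s′ d + k + 4
      ≤⟨ +-monoˡ-≤ 4 (+-monoˡ-≤ k (four-terms≤sum s′ a≢b a≢c a≢d b≢c b≢d c≢d)) ⟩
    sum s′ + k + 4
      ≡⟨ cong (λ m → sum s′ + m + 4) (sum-one {k}) ⟨
    sum s′ + sum {k} (λ _ → 1) + 4
      ≡⟨ cong (_+ 4) (∑-distrib-+ s′ (λ _ → 1)) ⟨
    sum (λ i → s′ i + 1) + 4
      ≡⟨ cong (_+ 4) (trans (sum-cong-≗ (sym ∘ s≡s′+1)) sum-classSize) ⟩
    n + 4
      ∎
    where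
    open ≤-Reasoning
    s = classSize
    s′ : Fin k → ℕ
    s′ i = s i ∸ 1
    s≡s′+1 : ∀ i → s i ≡ s′ i + 1
    s≡s′+1 i = sym (m∸n+n≡m (classSize-pos i))
    shift : ∀ w x y z k → (w + 1) + (x + 1) + (y + 1) + (z + 1) + k ≡ w + x + y + z + k + 4
    shift = solve-∀

  coalition-irrefl : ∀ {i j} → CCGAdj G π i j → i ≢ j
  coalition-irrefl {i} (disjoint , _) refl = disjoint v (⇒∈-part vi) (⇒∈-part vi)
    where
    v = proj₁ (representative i)
    vi = proj₂ (representative i)

  coalition-sym : ∀ {i j} → CCGAdj G π i j → CCGAdj G π j i
  coalition-sym {i} {j} (disjoint , ¬cds-i , ¬cds-j , cds) =
    (λ x x∈j x∈i → disjoint x x∈i x∈j) , ¬cds-j , ¬cds-i ,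
    subst (IsCDS G) (zipWith-comm Bool.∨-comm (part π i) (part π j)) cds

  module _ (subcubic : ∀ v → degree G v ≤ 3) where

    coalition-bound : ∀ {i j} → CCGAdj G π i j → n ≤ 2 * (classSize i + classSize j) + 2
    coalition-bound {i} {j} (_ , _ , _ , cds) = ≤-trans
      (cds-bound G subcubic _ cds (p⊆p∪q (part π j) (⇒∈-part (proj₂ (representative i)))))
      (+-monoˡ-≤ 2 (*-monoʳ-≤ 2 (≤-trans (≤-reflexive (size-cong (lookup-part-∪ i j)))
                                          (size-∨ (class i) (class j)))))

    singleton-cds-bound : ∀ i → IsCDS G (part π i) → ∣ part π i ∣ ≡ 1 → n ≤ 4
    singleton-cds-bound i (dom , _) one = ≤-trans (m≤m+n n _)
      (≤-trans (dominating-bound G subcubic (part π i) dom)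
               (≤-reflexive (cong (4 *_) (trans (sym (∣∣≡size (part π i))) one))))

    module _ (7≤k : 6 < k) where

      coalition-partner : IsCCPartition G π → ∀ i → ∃ (CCGAdj G π i)
      coalition-partner cc i with cc i
      ... | inj₁ (cds , one) = contradiction
        (≤-trans 7≤k (≤-trans classes≤vertices (singleton-cds-bound i cds one))) (from-no (7 ≤? 4))
      ... | inj₂ partner     = partner

      no-disjoint-coalitions : NoDisjointEdges (CCGAdj G π)
      no-disjoint-coalitions {a} {b} {c} {d} ab cd a≢c a≢d b≢c b≢d = <⇒≱ 7≤k
        (two-cds-arithmetic {a = classSize a} {classSize b} {classSize c} {classSize d}
          (four-classes-bound (coalition-irrefl ab) a≢c a≢d b≢c b≢d (coalition-irrefl cd))
          (coalition-bound ab) (coalition-bound cd))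

      coalition-star : IsCCPartition G π → ∃ (IsStar (CCGAdj G π))
      coalition-star cc = star-centre (CCGAdj G π) (≤-trans (s≤s (s≤s (s≤s (s≤s z≤n)))) 7≤k)
        coalition-sym (coalition-partner cc) no-disjoint-coalitions

-- The centre of the coalition star

centre-arithmetic : ∀ {n k r s i} → 3 ≤ k → 2 ≤ r →
                    k * r + i ≤ 3 * s + r → 2 * s ≤ i + 2 * r → k + s ≤ n + 1 → 3 * k ≤ n + 7
centre-arithmetic {k = 1} (s≤s ())
centre-arithmetic {k = 2} (s≤s (s≤s ()))
centre-arithmetic {n} {suc (suc (suc k))} {r} {s} {i} _ 2≤r edge-count forest-count vertex-count =
  +-cancelʳ-≤ (k * 2) _ _ (begin
    3 * (3 + k) + k * 2          ≡⟨ regroup k ⟩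
    (3 + k) + k * 2 + 6 + k * 2  ≤⟨ +-monoˡ-≤ (k * 2) (+-monoˡ-≤ 6 (+-monoʳ-≤ (3 + k) 2k≤s)) ⟩
    (3 + k) + s + 6 + k * 2      ≤⟨ +-monoˡ-≤ (k * 2) (+-monoˡ-≤ 6 vertex-count) ⟩
    n + 1 + 6 + k * 2            ≡⟨ cong (_+ k * 2) (+-assoc n 1 6) ⟩
    n + 7 + k * 2                ∎)
  where
  open ≤-Reasoning
  regroup : ∀ k → 3 * (3 + k) + k * 2 ≡ (3 + k) + k * 2 + 6 + k * 2
  regroup = solve-∀
  lhs : ∀ k r i s → (3 + k) * r + i + 2 * s ≡ (k * r + 3 * r + 2 * s) + i
  lhs = solve-∀
  kr≤s : k * r ≤ s
  kr≤s = +-cancelʳ-≤ (3 * r) _ _ (+-cancelʳ-≤ (2 * s) _ _ (+-cancelʳ-≤ i _ _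
    (subst₂ _≤_ (lhs k r i s) (swap r i s) (+-mono-≤ edge-count forest-count))))
    where
    swap : ∀ r i s → 3 * s + r + (i + 2 * r) ≡ (s + 3 * r + 2 * s) + i
    swap = solve-∀
  2k≤s : k * 2 ≤ s
  2k≤s = ≤-trans (*-monoʳ-≤ k 2≤r) kr≤s

module Centre {n} (G : Graph n) (subcubic : ∀ v → degree G v ≤ 3) {k} (π : Partition G k) (7≤k : 6 < k)
              (c : Fin k) (spoke : ∀ l → l ≢ c → CCGAdj G π c l) where

  A : Fin n → Bool
  A = class G π c

  centre-not-cds : ¬ IsCDS G (part π c)
  centre-not-cds with fresh (≤-trans (s≤s (s≤s (s≤s (s≤s z≤n)))) 7≤k) c c c
  ... | l , l≢c , _ = proj₁ (proj₂ (spoke l l≢c))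

  leaf-cds : ∀ l → l ≢ c → IsCDS G (part π c ∪ part π l)
  leaf-cds l l≢c = proj₂ (proj₂ (proj₂ (spoke l l≢c)))

  in-leaf : ∀ {l v} → A v ≡ false → v ∈ part π c ∪ part π l → class G π l v ≡ true
  in-leaf {l} Av v∈c∪l with x∈p∪q⁻ (part π c) (part π l) v∈c∪l
  ... | inj₁ v∈c = contradiction (trans (sym (∈-part⇒ G π v∈c)) Av) true≢false
  ... | inj₂ v∈l = ∈-part⇒ G π v∈l

  undominated-bound : ∀ x → x ∉ part π c → (∀ u → u ∈ part π c → adj G x u ≡ false) → k ≤ 5
  undominated-bound x x∉A x-alone = ≤-trans (classes-meeting-bound G π N[x] c meets) (+-monoˡ-≤ 1 N[x]≤4)
    where
    N[x] : Fin n → Bool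
    N[x] v = (v == x) ∨ adj G x v
    N[x]≤4 : size N[x] ≤ 4
    N[x]≤4 = ≤-trans (size-∨ (_== x) (adj G x))
      (+-mono-≤ (≤-reflexive (sum-δ (λ _ → 1) x)) (subst (_≤ 3) (degree≡deg G x) (subcubic x)))
    Ax : A x ≡ false
    Ax with A x in Ax
    ... | true  = contradiction (⇒∈-part G π Ax) x∉A
    ... | false = refl
    meets : ∀ l → l ≢ c → ∃ λ v → class G π l v ≡ true × N[x] v ≡ true
    meets l l≢c with class G π l x in lx
    ... | true  = x , lx , cong (_∨ adj G x x) (==-refl x)
    ... | false with proj₁ (leaf-cds l l≢c) x (λ x∈c∪l → true≢false (trans (sym (in-leaf Ax x∈c∪l)) lx))
    ...   | u , u∈c∪l , xu = u , in-leaf Au u∈c∪l , trans (cong ((u == x) ∨_) xu) (Bool.∨-zeroʳ _)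
      where
      Au : A u ≡ false
      Au with A u in Au
      ... | true  = contradiction (trans (sym xu) (x-alone u (⇒∈-part G π Au))) true≢false
      ... | false = refl

  record UnionOfComponents (X : Fin n → Bool) : Set where
    field
      ⊆A     : ∀ x → X x ≡ true → A x ≡ true
      closed : ∀ x y → X x ≡ true → A y ≡ true → X y ≡ false → adj G x y ≡ false
  open UnionOfComponents

  -- r stands for the number of components of G[X]: G[X] has at least |X| − r edges, and each
  -- component sends an edge to every leaf class because its union with the centre is connected.
  ComponentBound : (Fin n → Bool) → ℕ → Set
  ComponentBound X r = 2 * size X ≤ inner G X + 2 * r × (∀ l → l ≢ c → r ≤ edges G X (class G π l))

  connected-component-bound : ∀ {X x₀ a₀} → UnionOfComponents X → InducedConnected G ⟪ X ⟫ →
                              X x₀ ≡ true → A a₀ ≡ true → X a₀ ≡ false → ComponentBound X 1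
  connected-component-bound {X} {x₀} {a₀} X-comp conn Xx₀ Aa₀ Xa₀ = forest , edge-to-leaf
    where
    forest : 2 * size X ≤ inner G X + 2
    forest = subst₂ (λ s i → 2 * s ≤ i + 2) (size-cong (lookup∘tabulate X))
                    (edges-cong G (lookup∘tabulate X) (lookup∘tabulate X)) (connected-bound G ⟪ X ⟫ conn (⇒∈⟪⟫ Xx₀))
    edge-to-leaf : ∀ l → l ≢ c → 1 ≤ edges G X (class G π l)
    edge-to-leaf l l≢c
      with path-exit G X (proj₂ (leaf-cds l l≢c) x₀ a₀ (in-union (⊆A X-comp x₀ Xx₀)) (in-union Aa₀)) Xx₀ Xa₀
      where
      in-union : ∀ {y} → A y ≡ true → y ∈ part π c ∪ part π l
      in-union Ay = p⊆p∪q (part π l) (⇒∈-part G π Ay)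
    ... | s , t , Xs , t∈c∪l , Xt , st with A t in At
    ...   | true  = contradiction (trans (sym st) (closed X-comp s t Xs At Xt)) true≢false
    ...   | false = edges-pos G X (class G π l) Xs (in-leaf At t∈c∪l) st

  module Split {X} (X-comp : UnionOfComponents X) {u v} (Xu : X u ≡ true) (Xv : X v ≡ true)
               (u↛v : ¬ PathIn G ⟪ X ⟫ u v) (reach? : ∀ w → Dec (PathIn G ⟪ X ⟫ u w)) where

    reached : Fin n → Bool
    reached w = ⌊ reach? w ⌋

    reached⇒path : ∀ {w} → reached w ≡ true → PathIn G ⟪ X ⟫ u w
    reached⇒path {w} rw with reach? w
    ... | yes u→w = u→w

    path⇒reached : ∀ {w} → PathIn G ⟪ X ⟫ u w → reached w ≡ true
    path⇒reached {w} u→w with reach? w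
    ... | yes _   = refl
    ... | no  u↛w = contradiction u→w u↛w

    X₁ X₂ : Fin n → Bool
    X₁ w = X w ∧ reached w
    X₂ w = X w ∧ not (reached w)

    u-reached : reached u ≡ true
    u-reached = path⇒reached (here (⇒∈⟪⟫ Xu))

    X₁u : X₁ u ≡ true
    X₁u rewrite Xu = u-reached

    v-unreached : reached v ≡ false
    v-unreached with reach? v
    ... | yes u→v = contradiction u→v u↛v
    ... | no  _   = refl

    X₁v : X₁ v ≡ false
    X₁v rewrite Xv | v-unreached = refl

    X₂u : X₂ u ≡ false
    X₂u rewrite u-reached = Bool.∧-zeroʳ (X u)

    X₂v : X₂ v ≡ true
    X₂v rewrite Xv | v-unreached = refl

    X₁-comp : UnionOfComponents X₁
    X₁-comp = record { ⊆A = λ x → ⊆A X-comp x ∘ proj₁ ∘ ∧-true ; closed = closed₁ }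
      where
      closed₁ : ∀ x y → X₁ x ≡ true → A y ≡ true → X₁ y ≡ false → adj G x y ≡ false
      closed₁ x y X₁x Ay X₁y with ∧-true X₁x | X y in Xy | adj G x y in xy
      ... | _        | _     | false = refl
      ... | Xx , rx  | false | true  = contradiction (trans (sym xy) (closed X-comp x y Xx Ay Xy)) true≢false
      ... | Xx , rx  | true  | true  = contradiction
        (trans (sym (path⇒reached (path-snoc G (reached⇒path rx) xy (⇒∈⟪⟫ Xy))))
               (trans (cong (_∧ reached y) (sym Xy)) X₁y)) true≢false

    X₂-comp : UnionOfComponents X₂
    X₂-comp = record { ⊆A = λ x → ⊆A X-comp x ∘ proj₁ ∘ ∧-true ; closed = closed₂ }
      where
      closed₂ : ∀ x y → X₂ x ≡ true → A y ≡ true → X₂ y ≡ false → adj G x y ≡ false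
      closed₂ x y X₂x Ay X₂y with ∧-true X₂x | X y in Xy | adj G x y in xy
      ... | _        | _     | false = refl
      ... | Xx , ¬rx | false | true  = contradiction (trans (sym xy) (closed X-comp x y Xx Ay Xy)) true≢false
      ... | Xx , ¬rx | true  | true  with reached y in ry
      ...   | true  = contradiction
        (trans (sym (path⇒reached (path-snoc G (reached⇒path ry) (trans (Graph.sym G y x) xy) (⇒∈⟪⟫ Xx))))
               (not-true ¬rx)) true≢false
      ...   | false = contradiction (trans (cong (_∧ true) (sym Xy)) X₂y) true≢false

    size-split : size X ≡ size X₁ + size X₂
    size-split = trans (sum-cong-≗ λ w → []·-∧-split (X w) (reached w) 1)
                       (∑-distrib-+ (𝟙 ∘ X₁) (𝟙 ∘ X₂))

    edges-split : ∀ T → edges G X T ≡ edges G X₁ T + edges G X₂ T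
    edges-split T = trans (sum-cong-≗ λ w → []·-∧-split (X w) (reached w) _)
                          (∑-distrib-+ (λ w → [ X₁ w ]· degIn G T w) _)

    inner-split : inner G X₁ + inner G X₂ ≤ inner G X
    inner-split = ≤-trans (+-mono-≤ (edges-monoʳ G X₁ {X₁} {X} (λ _ → proj₁ ∘ ∧-true))
                                    (edges-monoʳ G X₂ {X₂} {X} (λ _ → proj₁ ∘ ∧-true)))
                          (≤-reflexive (sym (edges-split X)))

    combine : ∀ {r₁ r₂} → ComponentBound X₁ r₁ → ComponentBound X₂ r₂ →
              ComponentBound X (r₁ + r₂)
    combine {r₁} {r₂} (forest₁ , leaves₁) (forest₂ , leaves₂) = forest , leaves
      where
      forest : 2 * size X ≤ inner G X + 2 * (r₁ + r₂)
      forest = begin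
        2 * size X                                        ≡⟨ cong (2 *_) size-split ⟩
        2 * (size X₁ + size X₂)                           ≡⟨ *-distribˡ-+ 2 (size X₁) (size X₂) ⟩
        2 * size X₁ + 2 * size X₂                         ≤⟨ +-mono-≤ forest₁ forest₂ ⟩
        (inner G X₁ + 2 * r₁) + (inner G X₂ + 2 * r₂)     ≡⟨ regroup (inner G X₁) r₁ (inner G X₂) r₂ ⟩
        (inner G X₁ + inner G X₂) + 2 * (r₁ + r₂)         ≤⟨ +-monoˡ-≤ _ inner-split ⟩
        inner G X + 2 * (r₁ + r₂)                         ∎
        where
        open ≤-Reasoning
        regroup : ∀ a b c d → (a + 2 * b) + (c + 2 * d) ≡ (a + c) + 2 * (b + d)
        regroup = solve-∀
      leaves : ∀ l → l ≢ c → r₁ + r₂ ≤ edges G X (class G π l)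
      leaves l l≢c = ≤-trans (+-mono-≤ (leaves₁ l l≢c) (leaves₂ l l≢c))
                             (≤-reflexive (sym (edges-split (class G π l))))

    X₁<X : size X₁ < size X
    X₁<X = subst₂ _≤_ (+-comm (size X₁) 1) (sym size-split) (+-monoʳ-≤ (size X₁) (size-pos X₂ X₂v))

    X₂<X : size X₂ < size X
    X₂<X = subst₂ _≤_ (+-comm (size X₂) 1) (trans (+-comm (size X₂) (size X₁)) (sym size-split))
                      (+-monoʳ-≤ (size X₂) (size-pos X₁ X₁u))

  component-bound : ∀ fuel {X x₀ a₀} → size X < fuel → UnionOfComponents X → X x₀ ≡ true →
                    A a₀ ≡ true → X a₀ ≡ false → ¬ ¬ ∃ λ r → 1 ≤ r × ComponentBound X r
  component-bound (suc fuel) {X} X<fuel X-comp Xx₀ Aa₀ Xa₀ = ¬¬-connectivity G X >>= by-cases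
    where
    by-cases : Connectivity G X → ¬ ¬ ∃ λ r → 1 ≤ r × ComponentBound X r
    by-cases (connected conn) = pure (1 , ≤-refl , connected-component-bound X-comp conn Xx₀ Aa₀ Xa₀)
    by-cases (split Xu Xv u↛v reach?) = do
      r₁ , 1≤r₁ , bound₁ ← component-bound fuel (<-≤-trans X₁<X (≤-pred X<fuel)) X₁-comp X₁u
                                           (⊆A X-comp _ Xv) X₁v
      r₂ , _    , bound₂ ← component-bound fuel (<-≤-trans X₂<X (≤-pred X<fuel)) X₂-comp X₂v
                                           (⊆A X-comp _ Xu) X₂u
      pure (r₁ + r₂ , ≤-trans 1≤r₁ (m≤m+n r₁ r₂) , combine bound₁ bound₂)
      where open Split X-comp Xu Xv u↛v reach?

  A-comp : UnionOfComponents A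
  A-comp = record
    { ⊆A     = λ _ Ax → Ax
    ; closed = λ _ _ _ Ay ¬Ay → contradiction (trans (sym Ay) ¬Ay) true≢false
    }

  disconnected-bound : ¬ InducedConnected G ⟪ A ⟫ → ¬ ¬ ∃ λ r → 2 ≤ r × ComponentBound A r
  disconnected-bound disconnected = ¬¬-connectivity G A >>= by-cases
    where
    by-cases : Connectivity G A → ¬ ¬ ∃ λ r → 2 ≤ r × ComponentBound A r
    by-cases (connected conn) = contradiction conn disconnected
    by-cases (split Au Av u↛v reach?) = do
      r₁ , 1≤r₁ , bound₁ ← component-bound (suc (size A)) (≤-trans X₁<X (n≤1+n _)) X₁-comp X₁u Av X₁v
      r₂ , 1≤r₂ , bound₂ ← component-bound (suc (size A)) (≤-trans X₂<X (n≤1+n _)) X₂-comp X₂v Au X₂u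
      pure (r₁ + r₂ , +-mono-≤ 1≤r₁ 1≤r₂ , combine bound₁ bound₂)
      where open Split A-comp Au Av u↛v reach?

  edge-count : ∀ r → (∀ l → l ≢ c → r ≤ edges G A (class G π l)) → k * r + inner G A ≤ 3 * size A + r
  edge-count r leaves = begin
    k * r + inner G A                       ≤⟨ sum-except (λ l → edges G A (class G π l)) c leaves ⟩
    sum (λ l → edges G A (class G π l)) + r ≡⟨ cong (_+ r) (sum-edges-classes G π A) ⟩
    sum (λ x → [ A x ]· deg G x) + r        ≤⟨ +-monoˡ-≤ r (sum-deg≤ G subcubic A) ⟩
    3 * size A + r                          ∎
    where open ≤-Reasoning

  vertex-count : k + size A ≤ n + 1
  vertex-count = subst₂ (λ m m′ → m + size A ≤ m′ + 1) (*-identityʳ k) (sum-classSize G π)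
    (sum-except (classSize G π) c (λ l _ → classSize-pos G π l))

  order-bound : 3 * k ≤ n + 7
  order-bound with dominating-or-undominated G (part π c)
  ... | inj₂ (x , x∉A , x-alone) =
    contradiction (≤-trans 7≤k (undominated-bound x x∉A x-alone)) (from-no (7 ≤? 5))
  ... | inj₁ dom = decidable-stable (3 * k ≤? n + 7) do
    r , 2≤r , forest , leaves ← disconnected-bound (λ conn → centre-not-cds (dom , conn))
    pure (centre-arithmetic (≤-trans (s≤s (s≤s (s≤s z≤n))) 7≤k) 2≤r (edge-count r leaves) forest vertex-count)

-- The extremal family

≡ᵇ-refl : ∀ x → (x ≡ᵇ x) ≡ true
≡ᵇ-refl zero    = refl
≡ᵇ-refl (suc x) = ≡ᵇ-refl x

≡ᵇ-true⇒≡ : ∀ {x y} → (x ≡ᵇ y) ≡ true → x ≡ y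
≡ᵇ-true⇒≡ {zero}  {zero}  _  = refl
≡ᵇ-true⇒≡ {suc x} {suc y} eq = cong suc (≡ᵇ-true⇒≡ eq)

≡ᵇ-sym : ∀ x y → (x ≡ᵇ y) ≡ (y ≡ᵇ x)
≡ᵇ-sym zero    zero    = refl
≡ᵇ-sym zero    (suc y) = refl
≡ᵇ-sym (suc x) zero    = refl
≡ᵇ-sym (suc x) (suc y) = ≡ᵇ-sym x y

≡ᵇ-suc : ∀ x → (x ≡ᵇ suc x) ≡ false
≡ᵇ-suc zero    = refl
≡ᵇ-suc (suc x) = ≡ᵇ-suc x

𝟙≤1 : ∀ b → 𝟙 b ≤ 1
𝟙≤1 true  = ≤-refl
𝟙≤1 false = z≤n

count-≡ᵇ : ∀ N c → sum {N} (λ j → 𝟙 (toℕ j ≡ᵇ c)) ≤ 𝟙 (c <ᵇ N)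
count-≡ᵇ zero    c       = z≤n
count-≡ᵇ (suc N) zero    = s≤s (≤-reflexive (sum-zero {N}))
count-≡ᵇ (suc N) (suc c) = count-≡ᵇ N c

count-≡ᵇ≤1 : ∀ N c → sum {N} (λ j → 𝟙 (c ≡ᵇ toℕ j)) ≤ 1
count-≡ᵇ≤1 N c = ≤-trans (≤-reflexive (sum-cong-≗ {N} (λ j → cong 𝟙 (≡ᵇ-sym c (toℕ j)))))
                         (≤-trans (count-≡ᵇ N c) (𝟙≤1 _))

pathAdj : ℕ → ℕ → Bool
pathAdj x y = (y ≡ᵇ suc x) ∨ (x ≡ᵇ suc y)

pathAdj-sym : ∀ x y → pathAdj x y ≡ pathAdj y x
pathAdj-sym x y = Bool.∨-comm (y ≡ᵇ suc x) (x ≡ᵇ suc y)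

pathAdj-irrefl : ∀ x → pathAdj x x ≡ false
pathAdj-irrefl x rewrite ≡ᵇ-suc x = refl

path-degree : ∀ c x → sum {c} (λ j → 𝟙 (pathAdj x (toℕ j))) ≤ 𝟙 (suc x <ᵇ c) + 𝟙 (0 <ᵇ x)
path-degree c x = begin
  sum {c} (λ j → 𝟙 (pathAdj x (toℕ j)))
    ≤⟨ sum-mono-≤ {c} (λ j → 𝟙-∨ (toℕ j ≡ᵇ suc x) (x ≡ᵇ suc (toℕ j))) ⟩
  sum {c} (λ j → 𝟙 (toℕ j ≡ᵇ suc x) + 𝟙 (x ≡ᵇ suc (toℕ j)))
    ≡⟨ ∑-distrib-+ {c} (λ j → 𝟙 (toℕ j ≡ᵇ suc x)) _ ⟩
  sum {c} (λ j → 𝟙 (toℕ j ≡ᵇ suc x)) + sum {c} (λ j → 𝟙 (x ≡ᵇ suc (toℕ j)))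
    ≤⟨ +-mono-≤ (count-≡ᵇ c (suc x)) (predecessors x) ⟩
  𝟙 (suc x <ᵇ c) + 𝟙 (0 <ᵇ x)
    ∎
  where
  open ≤-Reasoning
  predecessors : ∀ x → sum {c} (λ j → 𝟙 (x ≡ᵇ suc (toℕ j))) ≤ 𝟙 (0 <ᵇ x)
  predecessors zero    = ≤-reflexive (sum-zero {c})
  predecessors (suc x) = count-≡ᵇ≤1 c x

-- Leaf i hangs from vertex min(i − 1, c − 1) of a path with c vertices: the two ends carry two leaves
-- and the inner vertices one, so up to c + 2 leaves fit without exceeding degree 3.
anchor : ℕ → ℕ → ℕ
anchor c i = (i ∸ 1) ⊓ (c ∸ 1)

anchor< : ∀ c i → 0 < c → anchor c i < c
anchor< (suc c) i _ = s≤s (m⊓n≤n (i ∸ 1) c)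

anchor-fibre : ∀ c i j → i ≤ suc c → (anchor c i ≡ᵇ j) ≡ true →
               i ≡ suc j ⊎ (j ≡ 0 × i ≡ 0) ⊎ (suc j ≡ c × i ≡ suc c)
anchor-fibre c       zero          j _     eq = inj₂ (inj₁ (sym (≡ᵇ-true⇒≡ eq) , refl))
anchor-fibre zero    (suc zero)    j _     eq = inj₁ (cong suc (≡ᵇ-true⇒≡ eq))
anchor-fibre zero    (suc (suc i)) j (s≤s ())
anchor-fibre (suc c) (suc i)       j i≤c+1 eq with i ≤? c
... | yes i≤c = inj₁ (cong suc (trans (sym (m≤n⇒m⊓n≡m i≤c)) (≡ᵇ-true⇒≡ eq)))
... | no  i≰c = inj₂ (inj₂ (cong suc j≡c , cong suc i≡c+1))
  where
  i≡c+1 : i ≡ suc c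
  i≡c+1 = ≤-antisym (≤-pred i≤c+1) (≰⇒> i≰c)
  j≡c : j ≡ c
  j≡c = trans (sym (≡ᵇ-true⇒≡ eq)) (m≥n⇒m⊓n≡n (≤-trans (n≤1+n c) (≤-reflexive (sym i≡c+1))))

leaves-at : ∀ m c → m ≤ suc (suc c) → ∀ j →
            sum {m} (λ i → 𝟙 (anchor c (toℕ i) ≡ᵇ j)) ≤ 1 + 𝟙 (0 ≡ᵇ j) + 𝟙 (suc j ≡ᵇ c)
leaves-at m c m≤c+2 j = begin
  sum {m} (λ i → 𝟙 (anchor c (toℕ i) ≡ᵇ j))
    ≤⟨ sum-mono-≤ pointwise ⟩
  sum (λ i → f₁ i + [ 0 ≡ᵇ j ]· f₂ i + [ suc j ≡ᵇ c ]· f₃ i)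
    ≡⟨ ∑-distrib-+ (λ i → f₁ i + [ 0 ≡ᵇ j ]· f₂ i) _ ⟩
  sum (λ i → f₁ i + [ 0 ≡ᵇ j ]· f₂ i) + sum (λ i → [ suc j ≡ᵇ c ]· f₃ i)
    ≡⟨ cong₂ _+_ (∑-distrib-+ f₁ (λ i → [ 0 ≡ᵇ j ]· f₂ i)) (sym ([]·-sum (suc j ≡ᵇ c) f₃)) ⟩
  sum f₁ + sum (λ i → [ 0 ≡ᵇ j ]· f₂ i) + [ suc j ≡ᵇ c ]· sum f₃
    ≡⟨ cong (λ t → sum f₁ + t + [ suc j ≡ᵇ c ]· sum f₃) ([]·-sum (0 ≡ᵇ j) f₂) ⟨
  sum f₁ + [ 0 ≡ᵇ j ]· sum f₂ + [ suc j ≡ᵇ c ]· sum f₃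
    ≤⟨ +-mono-≤ (+-mono-≤ (at-most-one (suc j)) ([]·-≤𝟙 (0 ≡ᵇ j) (at-most-one 0)))
                ([]·-≤𝟙 (suc j ≡ᵇ c) (at-most-one (suc c))) ⟩
  1 + 𝟙 (0 ≡ᵇ j) + 𝟙 (suc j ≡ᵇ c)
    ∎
  where
  open ≤-Reasoning
  f₁ f₂ f₃ : Fin m → ℕ
  f₁ i = 𝟙 (toℕ i ≡ᵇ suc j)
  f₂ i = 𝟙 (toℕ i ≡ᵇ 0)
  f₃ i = 𝟙 (toℕ i ≡ᵇ suc c)
  at-most-one : ∀ x → sum {m} (λ i → 𝟙 (toℕ i ≡ᵇ x)) ≤ 1
  at-most-one x = ≤-trans (count-≡ᵇ m x) (𝟙≤1 _)
  []·-≤𝟙 : ∀ b {x} → x ≤ 1 → [ b ]· x ≤ 𝟙 b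
  []·-≤𝟙 true  x≤1 = x≤1
  []·-≤𝟙 false _   = z≤n
  pointwise : ∀ i → 𝟙 (anchor c (toℕ i) ≡ᵇ j) ≤ f₁ i + [ 0 ≡ᵇ j ]· f₂ i + [ suc j ≡ᵇ c ]· f₃ i
  pointwise i with anchor c (toℕ i) ≡ᵇ j in eq
  ... | false = z≤n
  ... | true with anchor-fibre c (toℕ i) j (≤-pred (≤-trans (toℕ<n i) m≤c+2)) eq
  ...   | inj₁ i≡j+1                 rewrite i≡j+1 | ≡ᵇ-refl j = s≤s z≤n
  ...   | inj₂ (inj₁ (j≡0 , i≡0))     rewrite j≡0 | i≡0 = s≤s z≤n
  ...   | inj₂ (inj₂ (j+1≡c , i≡c+1)) rewrite i≡c+1 | j+1≡c | ≡ᵇ-refl c = m≤n+m 1 _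

spine-degree : ∀ m c → m ≤ suc (suc c) → ∀ x →
               sum {c} (λ j → 𝟙 (pathAdj x (toℕ j))) + sum {m} (λ i → 𝟙 (anchor c (toℕ i) ≡ᵇ x)) ≤ 3
spine-degree m c m≤c+2 x = begin
  sum {c} (λ j → 𝟙 (pathAdj x (toℕ j))) + sum {m} (λ i → 𝟙 (anchor c (toℕ i) ≡ᵇ x))
    ≤⟨ +-mono-≤ (path-degree c x) (leaves-at m c m≤c+2 x) ⟩
  𝟙 (suc x <ᵇ c) + 𝟙 (0 <ᵇ x) + (1 + 𝟙 (0 ≡ᵇ x) + 𝟙 (suc x ≡ᵇ c))
    ≡⟨ regroup (𝟙 (suc x <ᵇ c)) (𝟙 (0 <ᵇ x)) (𝟙 (0 ≡ᵇ x)) (𝟙 (suc x ≡ᵇ c)) ⟩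
  (𝟙 (suc x <ᵇ c) + 𝟙 (suc x ≡ᵇ c)) + (𝟙 (0 <ᵇ x) + 𝟙 (0 ≡ᵇ x)) + 1
    ≤⟨ +-monoˡ-≤ 1 (+-mono-≤ (<ᵇ-or-≡ᵇ (suc x) c) (<ᵇ-or-≡ᵇ 0 x)) ⟩
  3 ∎
  where
  open ≤-Reasoning
  regroup : ∀ p q r s → p + q + (1 + r + s) ≡ (p + s) + (q + r) + 1
  regroup = solve-∀
  <ᵇ-or-≡ᵇ : ∀ x y → 𝟙 (x <ᵇ y) + 𝟙 (x ≡ᵇ y) ≤ 1
  <ᵇ-or-≡ᵇ zero    zero    = ≤-refl
  <ᵇ-or-≡ᵇ zero    (suc y) = ≤-refl
  <ᵇ-or-≡ᵇ (suc x) zero    = z≤n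
  <ᵇ-or-≡ᵇ (suc x) (suc y) = <ᵇ-or-≡ᵇ x y

sum-splitAt : ∀ x y (f : Fin (x + y) → ℕ) →
              sum f ≡ sum (λ i → f (i ↑ˡ y)) + sum (λ j → f (x ↑ʳ j))
sum-splitAt zero    y f = refl
sum-splitAt (suc x) y f = trans (cong (f zero +_) (sum-splitAt x y (f ∘ suc)))
  (sym (+-assoc (f zero) (sum (λ i → f (suc (i ↑ˡ y)))) (sum (λ j → f (suc (x ↑ʳ j))))))

module Construction (a b m : ℕ) (2≤a : 2 ≤ a) (m≤a+2 : m ≤ suc (suc a))
                    (2≤b : 2 ≤ b) (m≤b+2 : m ≤ suc (suc b)) (3<m : 3 < m) where

  N : ℕ
  N = a + b + m

  data Vertex : Set where
    P : Fin a → Vertex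
    Q : Fin b → Vertex
    L : Fin m → Vertex

  embP : Fin a → Fin N
  embP j = (j ↑ˡ b) ↑ˡ m
  embQ : Fin b → Fin N
  embQ j = (a ↑ʳ j) ↑ˡ m
  embL : Fin m → Fin N
  embL i = (a + b) ↑ʳ i

  vertex : Fin N → Vertex
  vertex u with splitAt (a + b) u
  ... | inj₂ i = L i
  ... | inj₁ w with splitAt a w
  ...   | inj₁ j = P j
  ...   | inj₂ j = Q j

  vertex-P : ∀ j → vertex (embP j) ≡ P j
  vertex-P j rewrite splitAt-↑ˡ (a + b) (j ↑ˡ b) m | splitAt-↑ˡ a j b = refl
  vertex-Q : ∀ j → vertex (embQ j) ≡ Q j
  vertex-Q j rewrite splitAt-↑ˡ (a + b) (a ↑ʳ j) m | splitAt-↑ʳ a b j = refl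
  vertex-L : ∀ i → vertex (embL i) ≡ L i
  vertex-L i rewrite splitAt-↑ʳ (a + b) m i = refl

  data Shape : Fin N → Set where
    isP : ∀ j → Shape (embP j)
    isQ : ∀ j → Shape (embQ j)
    isL : ∀ i → Shape (embL i)

  shape : ∀ u → Shape u
  shape u with splitAt (a + b) u in eq
  ... | inj₂ i = subst Shape (splitAt⁻¹-↑ʳ eq) (isL i)
  ... | inj₁ w with splitAt a w in eq′
  ...   | inj₁ j = subst Shape (trans (cong (_↑ˡ m) (splitAt⁻¹-↑ˡ eq′)) (splitAt⁻¹-↑ˡ eq)) (isP j)
  ...   | inj₂ j = subst Shape (trans (cong (_↑ˡ m) (splitAt⁻¹-↑ʳ eq′)) (splitAt⁻¹-↑ˡ eq)) (isQ j)

  E : Vertex → Vertex → Bool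
  E (P j) (P j′) = pathAdj (toℕ j) (toℕ j′)
  E (Q j) (Q j′) = pathAdj (toℕ j) (toℕ j′)
  E (P j) (L i)  = anchor a (toℕ i) ≡ᵇ toℕ j
  E (L i) (P j)  = anchor a (toℕ i) ≡ᵇ toℕ j
  E (Q j) (L i)  = anchor b (toℕ i) ≡ᵇ toℕ j
  E (L i) (Q j)  = anchor b (toℕ i) ≡ᵇ toℕ j
  E _     _      = false

  E-sym : ∀ x y → E x y ≡ E y x
  E-sym (P j) (P j′) = pathAdj-sym (toℕ j) (toℕ j′)
  E-sym (Q j) (Q j′) = pathAdj-sym (toℕ j) (toℕ j′)
  E-sym (P j) (Q j′) = refl
  E-sym (Q j) (P j′) = refl
  E-sym (P j) (L i)  = refl
  E-sym (L i) (P j)  = refl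
  E-sym (Q j) (L i)  = refl
  E-sym (L i) (Q j)  = refl
  E-sym (L i) (L i′) = refl

  E-irrefl : ∀ x → E x x ≡ false
  E-irrefl (P j) = pathAdj-irrefl (toℕ j)
  E-irrefl (Q j) = pathAdj-irrefl (toℕ j)
  E-irrefl (L i) = refl

  G : Graph N
  G = record
    { adj    = λ u v → E (vertex u) (vertex v)
    ; sym    = λ u v → E-sym (vertex u) (vertex v)
    ; irrefl = λ v → E-irrefl (vertex v)
    }

  sum-vertices : ∀ (f : Vertex → ℕ) →
                 sum (f ∘ vertex) ≡ sum (λ j → f (P j)) + sum (λ j → f (Q j)) + sum (λ i → f (L i))
  sum-vertices f = begin
    sum (f ∘ vertex)
      ≡⟨ sum-splitAt (a + b) m (f ∘ vertex) ⟩
    sum (λ w → f (vertex (w ↑ˡ m))) + sum (λ i → f (vertex (embL i)))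
      ≡⟨ cong₂ _+_ (sum-splitAt a b (λ w → f (vertex (w ↑ˡ m)))) (sum-cong-≗ (cong f ∘ vertex-L)) ⟩
    sum (λ j → f (vertex (embP j))) + sum (λ j → f (vertex (embQ j))) + sum (λ i → f (L i))
      ≡⟨ cong (_+ sum (λ i → f (L i)))
              (cong₂ _+_ (sum-cong-≗ (cong f ∘ vertex-P)) (sum-cong-≗ (cong f ∘ vertex-Q))) ⟩
    sum (λ j → f (P j)) + sum (λ j → f (Q j)) + sum (λ i → f (L i))
      ∎
    where open ≡-Reasoning

  E-degree : ∀ x → sum (λ j → 𝟙 (E x (P j))) + sum (λ j → 𝟙 (E x (Q j))) + sum (λ i → 𝟙 (E x (L i))) ≤ 3
  E-degree (P j) = subst (λ t → t + sum (λ i → 𝟙 (E (P j) (L i))) ≤ 3)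
    (sym (trans (cong (sum (λ j′ → 𝟙 (E (P j) (P j′))) +_) (sum-zero {b})) (+-identityʳ _)))
    (spine-degree m a m≤a+2 (toℕ j))
  E-degree (Q j) = subst (λ t → t + sum (λ i → 𝟙 (E (Q j) (L i))) ≤ 3)
    (sym (cong (_+ sum (λ j′ → 𝟙 (E (Q j) (Q j′)))) (sum-zero {a})))
    (spine-degree m b m≤b+2 (toℕ j))
  E-degree (L i) = subst (_≤ 3)
    (sym (trans (cong (sum (λ j → 𝟙 (E (L i) (P j))) + sum (λ j → 𝟙 (E (L i) (Q j))) +_) (sum-zero {m}))
                (+-identityʳ _)))
    (≤-trans (+-mono-≤ (count-≡ᵇ≤1 a (anchor a (toℕ i))) (count-≡ᵇ≤1 b (anchor b (toℕ i)))) (n≤1+n 2))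

  subcubic : ∀ v → degree G v ≤ 3
  subcubic v = subst (_≤ 3) (sym (trans (degree≡deg G v) (sum-vertices (𝟙 ∘ E (vertex v)))))
                     (E-degree (vertex v))

  0<a : 0 < a
  0<a = ≤-trans (s≤s z≤n) 2≤a
  0<b : 0 < b
  0<b = ≤-trans (s≤s z≤n) 2≤b

  P₀ : Fin a
  P₀ = fromℕ< 0<a
  Q₀ : Fin b
  Q₀ = fromℕ< 0<b

  anchorP : Fin m → Fin a
  anchorP i = fromℕ< (anchor< a (toℕ i) 0<a)
  anchorQ : Fin m → Fin b
  anchorQ i = fromℕ< (anchor< b (toℕ i) 0<b)

  P-step : ∀ {j j′} → toℕ j ≡ suc (toℕ j′) → adj G (embP j) (embP j′) ≡ true
  P-step {j} {j′} j≡j′+1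
    rewrite vertex-P j | vertex-P j′ | j≡j′+1 | ≡ᵇ-refl (toℕ j′) = Bool.∨-zeroʳ _
  Q-step : ∀ {j j′} → toℕ j ≡ suc (toℕ j′) → adj G (embQ j) (embQ j′) ≡ true
  Q-step {j} {j′} j≡j′+1
    rewrite vertex-Q j | vertex-Q j′ | j≡j′+1 | ≡ᵇ-refl (toℕ j′) = Bool.∨-zeroʳ _

  L-anchorP : ∀ i → adj G (embL i) (embP (anchorP i)) ≡ true
  L-anchorP i rewrite vertex-L i | vertex-P (anchorP i) | toℕ-fromℕ< (anchor< a (toℕ i) 0<a) =
    ≡ᵇ-refl (anchor a (toℕ i))
  L-anchorQ : ∀ i → adj G (embL i) (embQ (anchorQ i)) ≡ true
  L-anchorQ i rewrite vertex-L i | vertex-Q (anchorQ i) | toℕ-fromℕ< (anchor< b (toℕ i) 0<b) =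
    ≡ᵇ-refl (anchor b (toℕ i))

  module Spanning (S : Subset N) (P⊆S : ∀ j → embP j ∈ S) (Q⊆S : ∀ j → embQ j ∈ S)
                  (i₀ : Fin m) (i₀∈S : embL i₀ ∈ S) where

    along-P : ∀ t (t<a : t < a) → PathIn G S (embP (fromℕ< t<a)) (embP P₀)
    along-P zero    _   = here (P⊆S _)
    along-P (suc t) t<a =
      step (P⊆S _) (P-step (trans (toℕ-fromℕ< t<a) (cong suc (sym (toℕ-fromℕ< t<a′))))) (along-P t t<a′)
      where
      t<a′ = ≤-trans (n≤1+n _) t<a

    along-Q : ∀ t (t<b : t < b) → PathIn G S (embQ (fromℕ< t<b)) (embQ Q₀)
    along-Q zero    _   = here (Q⊆S _)
    along-Q (suc t) t<b =
      step (Q⊆S _) (Q-step (trans (toℕ-fromℕ< t<b) (cong suc (sym (toℕ-fromℕ< t<b′))))) (along-Q t t<b′)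
      where
      t<b′ = ≤-trans (n≤1+n _) t<b

    to-P₀ : ∀ j → PathIn G S (embP j) (embP P₀)
    to-P₀ j = subst (λ j → PathIn G S (embP j) (embP P₀)) (fromℕ<-toℕ j (toℕ<n j))
                    (along-P (toℕ j) (toℕ<n j))

    to-Q₀ : ∀ j → PathIn G S (embQ j) (embQ Q₀)
    to-Q₀ j = subst (λ j → PathIn G S (embQ j) (embQ Q₀)) (fromℕ<-toℕ j (toℕ<n j))
                    (along-Q (toℕ j) (toℕ<n j))

    Q₀-to-P₀ : PathIn G S (embQ Q₀) (embP P₀)
    Q₀-to-P₀ = path-++ G (path-reverse G (to-Q₀ (anchorQ i₀)))
      (step (Q⊆S _) (trans (Graph.sym G _ _) (L-anchorQ i₀)) (step i₀∈S (L-anchorP i₀) (to-P₀ (anchorP i₀))))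

    to-root : ∀ {w} → Shape w → w ∈ S → PathIn G S w (embP P₀)
    to-root (isP j) _   = to-P₀ j
    to-root (isQ j) _   = path-++ G (to-Q₀ j) Q₀-to-P₀
    to-root (isL i) i∈S = step i∈S (L-anchorP i) (to-P₀ (anchorP i))

    induced-connected : InducedConnected G S
    induced-connected u v u∈S v∈S = path-++ G (to-root (shape u) u∈S) (path-reverse G (to-root (shape v) v∈S))

  classOf : Vertex → Fin (suc m)
  classOf (P _) = zero
  classOf (Q _) = zero
  classOf (L i) = suc i

  π : Partition G (suc m)
  π = record { cls = classOf ∘ vertex ; surj = nonempty }
    where
    nonempty : ∀ i → ∃ λ v → classOf (vertex v) ≡ i
    nonempty zero    = embP P₀ , cong classOf (vertex-P P₀)
    nonempty (suc i) = embL i , cong classOf (vertex-L i)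

  ∈-class : ∀ {x i} → classOf (vertex x) ≡ i → x ∈ part π i
  ∈-class {x} {i} x↦i = ⇒∈-part G π (trans (cong (_== i) x↦i) (==-refl i))

  class-of : ∀ {x i} → x ∈ part π i → classOf (vertex x) ≡ i
  class-of x∈i = ==⇒≡ (∈-part⇒ G π x∈i)

  P∈spine : ∀ j → embP j ∈ part π zero
  P∈spine j = ∈-class (cong classOf (vertex-P j))
  Q∈spine : ∀ j → embQ j ∈ part π zero
  Q∈spine j = ∈-class (cong classOf (vertex-Q j))
  L∈leaf : ∀ i → embL i ∈ part π (suc i)
  L∈leaf i = ∈-class (cong classOf (vertex-L i))

  onP : Vertex → Bool
  onP (P _) = true
  onP _     = false

  spine-not-connected : ¬ InducedConnected G (part π zero)
  spine-not-connected conn = true≢false (begin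
    true                   ≡⟨ path-closed G (onP ∘ vertex) P-closed (conn _ _ (P∈spine P₀) (Q∈spine Q₀))
                                          (cong onP (vertex-P P₀)) ⟨
    onP (vertex (embQ Q₀)) ≡⟨ cong onP (vertex-Q Q₀) ⟩
    false                  ∎)
    where
    open ≡-Reasoning
    P-closed : ∀ x y → onP (vertex x) ≡ true → y ∈ part π zero → adj G x y ≡ true → onP (vertex y) ≡ true
    P-closed x y = closed (shape x) (shape y)
      where
      closed : ∀ {x y} → Shape x → Shape y →
               onP (vertex x) ≡ true → y ∈ part π zero → adj G x y ≡ true → onP (vertex y) ≡ true
      closed (isP _) (isP j′) _     _   _  = cong onP (vertex-P j′)
      closed (isP j) (isQ j′) _     _   xy = contradiction (trans (sym xy) (cong₂ E (vertex-P j) (vertex-Q j′))) true≢false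
      closed (isP _) (isL i)  _     y∈0 _  = contradiction (trans (sym (class-of y∈0)) (cong classOf (vertex-L i))) λ ()
      closed (isQ j) _        onP-x _   _  = contradiction (trans (sym onP-x) (cong onP (vertex-Q j))) true≢false
      closed (isL i) _        onP-x _   _  = contradiction (trans (sym onP-x) (cong onP (vertex-L i))) true≢false

  leaf-not-cds : ∀ i → ¬ IsCDS G (part π (suc i))
  leaf-not-cds i (dom , _) with fresh 3<m i i i
  ... | i′ , i′≢i , _ with dom (embL i′) (λ i′∈i → i′≢i (suc-injective (trans (sym (class-of (L∈leaf i′))) (class-of i′∈i))))
  ...   | u , u∈i , i′u = not-adjacent (shape u) u∈i i′u
    where
    not-adjacent : ∀ {u} → Shape u → u ∈ part π (suc i) → adj G (embL i′) u ≡ true → ⊥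
    not-adjacent (isP j)  u∈i _   = contradiction (trans (sym (class-of (P∈spine j))) (class-of u∈i)) λ ()
    not-adjacent (isQ j)  u∈i _   = contradiction (trans (sym (class-of (Q∈spine j))) (class-of u∈i)) λ ()
    not-adjacent (isL i″) _   i′u = contradiction (trans (sym i′u) (cong₂ E (vertex-L i′) (vertex-L i″))) true≢false

  coalition : ∀ i → CCGAdj G π zero (suc i)
  coalition i = classes-disjoint G π (λ ()) , spine-not-connected ∘ proj₂ , leaf-not-cds i , U-dominating , U-connected
    where
    U = part π zero ∪ part π (suc i)
    P∈U : ∀ j → embP j ∈ U
    P∈U j = p⊆p∪q (part π (suc i)) (P∈spine j)
    Q∈U : ∀ j → embQ j ∈ U
    Q∈U j = p⊆p∪q (part π (suc i)) (Q∈spine j)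
    U-dominating : Dominating G U
    U-dominating v v∉U = neighbour (shape v) v∉U
      where
      neighbour : ∀ {v} → Shape v → v ∉ U → ∃ λ u → u ∈ U × adj G v u ≡ true
      neighbour (isP j)  v∉U = contradiction (P∈U j) v∉U
      neighbour (isQ j)  v∉U = contradiction (Q∈U j) v∉U
      neighbour (isL i′) _   = embP (anchorP i′) , P∈U (anchorP i′) , L-anchorP i′
    U-connected : InducedConnected G U
    U-connected = Spanning.induced-connected U P∈U Q∈U i (q⊆p∪q (part π zero) (part π (suc i)) (L∈leaf i))

  is-cc-partition : IsCCPartition G π
  is-cc-partition zero    = inj₂ (suc (fromℕ< (≤-trans (s≤s z≤n) 3<m)) , coalition _)
  is-cc-partition (suc i) = inj₂ (zero , coalition-sym G π (coalition i))

  is-subcubic : Subcubic G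
  is-subcubic = Spanning.induced-connected ⊤ (λ _ → ∈⊤) (λ _ → ∈⊤) (fromℕ< (≤-trans (s≤s z≤n) 3<m)) ∈⊤ , subcubic

-- Certified small examples

listed : List (ℕ × ℕ) → ℕ → ℕ → Bool
listed es x y = any (λ (p , q) → (x ≡ᵇ p) ∧ (y ≡ᵇ q)) es

edgeListAdj : List (ℕ × ℕ) → ℕ → ℕ → Bool
edgeListAdj es x y = listed es x y ∨ listed es y x

loopless? : ∀ n es → Dec (∀ (v : Fin n) → edgeListAdj es (toℕ v) (toℕ v) ≡ false)
loopless? n es = all? λ v → edgeListAdj es (toℕ v) (toℕ v) Bool.≟ false

fromEdgeList : ∀ n (es : List (ℕ × ℕ)) → (∀ (v : Fin n) → edgeListAdj es (toℕ v) (toℕ v) ≡ false) →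
               Graph n
fromEdgeList n es loopless = record
  { adj    = λ u v → edgeListAdj es (toℕ u) (toℕ v)
  ; sym    = λ u v → Bool.∨-comm (listed es (toℕ u) (toℕ v)) (listed es (toℕ v) (toℕ u))
  ; irrefl = loopless
  }

nonempty? : ∀ {k} (classes : Vec (Fin k) n) → Dec (∀ i → ∃ λ v → lookup classes v ≡ i)
nonempty? classes = all? λ i → any? λ v → lookup classes v ≟ i

fromClassList : ∀ {k} (G : Graph n) (classes : Vec (Fin k) n) → (∀ i → ∃ λ v → lookup classes v ≡ i) →
                Partition G k
fromClassList G classes nonempty = record { cls = lookup classes ; surj = nonempty }

-- A root together with the parent and the depth of every vertex; entries outside the set are ignored.
TreeCertificate : ℕ → Set
TreeCertificate n = Fin n × Vec (Fin n) n × Vec ℕ n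

module _ (G : Graph n) where

  IsRootedTree : Subset n → TreeCertificate n → Set
  IsRootedTree p (r , parent , depth) = r ∈ p × ∀ w → w ∈ p → w ≡ r ⊎
    lookup parent w ∈ p × adj G w (lookup parent w) ≡ true × lookup depth (lookup parent w) < lookup depth w

  isRootedTree? : ∀ p t → Dec (IsRootedTree p t)
  isRootedTree? p (r , parent , depth) = (r ∈? p) ×-dec all? λ w → (w ∈? p) →-dec
    ((w ≟ r) ⊎-dec ((lookup parent w ∈? p) ×-dec (adj G w (lookup parent w) Bool.≟ true)
                     ×-dec (lookup depth (lookup parent w) <? lookup depth w)))

  rooted-tree-connected : ∀ p t → IsRootedTree p t → InducedConnected G p
  rooted-tree-connected p (r , parent , depth) (r∈p , tree) =
    rooted-tree⇒connected G p (lookup parent) (lookup depth) r∈p tree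

  module _ {k} (π : Partition G k) where

    CoalitionCertificate : Fin k → Fin k × TreeCertificate n → Set
    CoalitionCertificate i (j , t) = i ≢ j × ¬ Dominating G (part π i) × ¬ Dominating G (part π j) ×
      Dominating G (part π i ∪ part π j) × IsRootedTree (part π i ∪ part π j) t

    coalitionCertificate? : ∀ i c → Dec (CoalitionCertificate i c)
    coalitionCertificate? i (j , t) = ¬? (i ≟ j) ×-dec ¬? (dominating? G (part π i)) ×-dec
      ¬? (dominating? G (part π j)) ×-dec dominating? G (part π i ∪ part π j) ×-dec isRootedTree? (part π i ∪ part π j) t

    certified-coalition : ∀ i c → CoalitionCertificate i c → CCGAdj G π i (proj₁ c)
    certified-coalition i (j , t) (i≢j , ¬dom-i , ¬dom-j , dom , tree) =
      classes-disjoint G π i≢j , ¬dom-i ∘ proj₁ , ¬dom-j ∘ proj₁ , dom , rooted-tree-connected _ t tree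

    certified-partition? : ∀ certificates → Dec (∀ i → CoalitionCertificate i (lookup certificates i))
    certified-partition? certificates = all? λ i → coalitionCertificate? i (lookup certificates i)

    certified-partition : (certificates : Vec (Fin k × TreeCertificate n) k) →
                          (∀ i → CoalitionCertificate i (lookup certificates i)) → IsCCPartition G π
    certified-partition certificates valid i = inj₂ (_ , certified-coalition i (lookup certificates i) (valid i))

3k≤n+7⇒k≤bound : ∀ {n k} → 3 * k ≤ n + 7 → k ≤ bound n
3k≤n+7⇒k≤bound {n} {k} 3k≤n+7 = ≤-trans
  (subst (_≤ (n + 7) / 3) (m*n/n≡m k 3) (/-monoˡ-≤ 3 (subst (_≤ n + 7) (*-comm 3 k) 3k≤n+7)))
  (m≤n⊔m 6 ((n + 7) / 3))

cc-upper-bound : (n : ℕ) (G : Graph n) → Subcubic G →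
                 ∀ k (π : Partition G k) → IsCCPartition G π → k ≤ bound n
cc-upper-bound n G (_ , subcubic) k π cc with k ≤? 6
... | yes k≤6 = ≤-trans k≤6 (m≤m⊔n 6 ((n + 7) / 3))
... | no  k≰6 = 3k≤n+7⇒k≤bound (star-bound (coalition-star G π subcubic 7≤k cc))
  where
  7≤k = ≰⇒> k≰6
  star-bound : ∃ (IsStar (CCGAdj G π)) → 3 * k ≤ n + 7
  star-bound (c , spoke , _) = Centre.order-bound G subcubic π 7≤k c spoke

coalition-graph-star : (n : ℕ) (G : Graph n) → Subcubic G → ∀ k → 6 < k →
                       (π : Partition G k) → IsCCPartition G π → Isomorphic (CCGAdj G π) StarAdj
coalition-graph-star n G (_ , subcubic) k 7≤k π cc = isomorphic (coalition-star G π subcubic 7≤k cc)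
  where
  isomorphic : ∃ (IsStar (CCGAdj G π)) → Isomorphic (CCGAdj G π) StarAdj
  isomorphic (c , star) = star-isomorphic c (coalition-irrefl G π) (coalition-sym G π) star

Extremal : ℕ → Set
Extremal n = Σ (Graph n) λ G → Subcubic G × CCNumberIs G (bound n)

extremal : ∀ {n k} (G : Graph n) → Subcubic G → k ≡ bound n → (π : Partition G k) → IsCCPartition G π →
           Extremal n
extremal {n} G subcubic refl π cc = G , subcubic , (π , cc) , cc-upper-bound n G subcubic

certified-extremal : ∀ {n k} (G : Graph n) (π : Partition G k) → k ≡ bound n →
                     (coalitions : Vec (Fin k × TreeCertificate n) k) →
                     (∀ i → CoalitionCertificate G π i (lookup coalitions i)) →
                     (spanning : TreeCertificate n) → IsRootedTree G ⊤ spanning → (∀ v → degree G v ≤ 3) →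
                     Extremal n
certified-extremal G π k≡bound coalitions valid spanning tree subcubic =
  extremal G (rooted-tree-connected G ⊤ spanning tree , subcubic) k≡bound π (certified-partition G π coalitions valid)

bound-family : ∀ q e → e < 3 → bound (11 + q * 3 + e) ≡ 6 + q
bound-family q e e<3 = begin
  6 ⊔ ((11 + q * 3 + e + 7) / 3)   ≡⟨ cong (λ t → 6 ⊔ (t / 3)) (regroup q e) ⟩
  6 ⊔ ((e + (6 + q) * 3) / 3)      ≡⟨ cong (6 ⊔_) (+-distrib-/-∣ʳ e (divides (6 + q) refl)) ⟩
  6 ⊔ (e / 3 + (6 + q) * 3 / 3)    ≡⟨ cong (6 ⊔_) (cong₂ _+_ (m<n⇒m/n≡0 e<3) (m*n/n≡m (6 + q) 3)) ⟩
  6 ⊔ (6 + q)                      ≡⟨ m≤n⇒m⊔n≡n (m≤m+n 6 q) ⟩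
  6 + q                            ∎
  where
  open ≡-Reasoning
  regroup : ∀ q e → 11 + q * 3 + e + 7 ≡ e + (6 + q) * 3
  regroup = solve-∀

family-extremal : ∀ q eₐ e_b → eₐ ≤ 1 → e_b ≤ 1 → Extremal (11 + q * 3 + (eₐ + e_b))
family-extremal q eₐ e_b eₐ≤1 e_b≤1 = subst Extremal (size-eq q eₐ e_b)
  (extremal G is-subcubic (sym bound-eq) π is-cc-partition)
  where
  a = 3 + q + eₐ
  b = 3 + q + e_b
  m = 5 + q
  open Construction a b m (≤-trans (s≤s (s≤s z≤n)) (m≤m+n (3 + q) eₐ)) (m≤m+n (5 + q) eₐ)
                          (≤-trans (s≤s (s≤s z≤n)) (m≤m+n (3 + q) e_b)) (m≤m+n (5 + q) e_b)
                          (s≤s (s≤s (s≤s (s≤s z≤n))))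
  size-eq : ∀ q eₐ e_b → 3 + q + eₐ + (3 + q + e_b) + (5 + q) ≡ 11 + q * 3 + (eₐ + e_b)
  size-eq = solve-∀
  bound-eq : bound N ≡ suc m
  bound-eq = trans (cong bound (size-eq q eₐ e_b)) (bound-family q (eₐ + e_b) (s≤s (+-mono-≤ eₐ≤1 e_b≤1)))

order-≡ : ∀ {n} q e → 11 ≤ n → n ∸ 11 ≡ e + q * 3 → 11 + q * 3 + e ≡ n
order-≡ {n} q e 11≤n n-11≡ = begin
  11 + q * 3 + e    ≡⟨ +-assoc 11 (q * 3) e ⟩
  11 + (q * 3 + e)  ≡⟨ cong (11 +_) (trans (+-comm (q * 3) e) (sym n-11≡)) ⟩
  11 + (n ∸ 11)     ≡⟨ m+[n∸m]≡n 11≤n ⟩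
  n                 ∎
  where open ≡-Reasoning

extremal-≥11 : ∀ n → 11 ≤ n → Extremal n
extremal-≥11 n 11≤n with (n ∸ 11) divMod 3
... | result q zero             n-11≡ = subst Extremal (order-≡ q 0 11≤n n-11≡) (family-extremal q 0 0 z≤n z≤n)
... | result q (suc zero)       n-11≡ = subst Extremal (order-≡ q 1 11≤n n-11≡) (family-extremal q 0 1 z≤n ≤-refl)
... | result q (suc (suc zero)) n-11≡ = subst Extremal (order-≡ q 2 11≤n n-11≡) (family-extremal q 1 1 ≤-refl ≤-refl)


module Order-6 where

  edgeList : List (ℕ × ℕ)
  edgeList = (0 , 1) ∷ (1 , 2) ∷ (0 , 2) ∷ (3 , 4) ∷ (4 , 5) ∷ (3 , 5) ∷ (0 , 3) ∷ (1 , 4) ∷ (2 , 5) ∷ []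

  G : Graph 6
  G = fromEdgeList 6 edgeList (from-yes (loopless? 6 edgeList))

  classes : Vec (Fin 6) 6
  classes = # 0 ∷ # 1 ∷ # 2 ∷ # 3 ∷ # 4 ∷ # 5 ∷ []

  π : Partition G 6
  π = fromClassList G classes (from-yes (nonempty? classes))

  coalitions : Vec (Fin 6 × TreeCertificate 6) 6
  coalitions =
      (# 3 , # 0 , (# 0 ∷ # 1 ∷ # 2 ∷ # 0 ∷ # 4 ∷ # 5 ∷ []) , (0 ∷ 0 ∷ 0 ∷ 1 ∷ 0 ∷ 0 ∷ []))
    ∷ (# 4 , # 1 , (# 0 ∷ # 1 ∷ # 2 ∷ # 3 ∷ # 1 ∷ # 5 ∷ []) , (0 ∷ 0 ∷ 0 ∷ 0 ∷ 1 ∷ 0 ∷ []))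
    ∷ (# 5 , # 2 , (# 0 ∷ # 1 ∷ # 2 ∷ # 3 ∷ # 4 ∷ # 2 ∷ []) , (0 ∷ 0 ∷ 0 ∷ 0 ∷ 0 ∷ 1 ∷ []))
    ∷ (# 0 , # 0 , (# 0 ∷ # 1 ∷ # 2 ∷ # 0 ∷ # 4 ∷ # 5 ∷ []) , (0 ∷ 0 ∷ 0 ∷ 1 ∷ 0 ∷ 0 ∷ []))
    ∷ (# 1 , # 1 , (# 0 ∷ # 1 ∷ # 2 ∷ # 3 ∷ # 1 ∷ # 5 ∷ []) , (0 ∷ 0 ∷ 0 ∷ 0 ∷ 1 ∷ 0 ∷ []))
    ∷ (# 2 , # 2 , (# 0 ∷ # 1 ∷ # 2 ∷ # 3 ∷ # 4 ∷ # 2 ∷ []) , (0 ∷ 0 ∷ 0 ∷ 0 ∷ 0 ∷ 1 ∷ []))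
    ∷ []

  spanning : TreeCertificate 6
  spanning = # 0 , (# 0 ∷ # 0 ∷ # 0 ∷ # 0 ∷ # 1 ∷ # 2 ∷ []) , (0 ∷ 1 ∷ 1 ∷ 1 ∷ 2 ∷ 2 ∷ [])

  extremal-6 : Extremal 6
  extremal-6 = certified-extremal G π refl coalitions (from-yes (certified-partition? G π coalitions))
    spanning (from-yes (isRootedTree? G ⊤ spanning)) (from-yes (all? λ v → degree G v ≤? 3))

module Order-8 where

  edgeList : List (ℕ × ℕ)
  edgeList = (0 , 5) ∷ (0 , 6) ∷ (0 , 7) ∷ (1 , 3) ∷ (1 , 5) ∷ (1 , 6)
           ∷ (2 , 3) ∷ (2 , 4) ∷ (2 , 5) ∷ (3 , 7) ∷ (4 , 6) ∷ (4 , 7) ∷ []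

  G : Graph 8
  G = fromEdgeList 8 edgeList (from-yes (loopless? 8 edgeList))

  classes : Vec (Fin 6) 8
  classes = # 0 ∷ # 1 ∷ # 2 ∷ # 1 ∷ # 3 ∷ # 2 ∷ # 4 ∷ # 5 ∷ []

  π : Partition G 6
  π = fromClassList G classes (from-yes (nonempty? classes))

  coalitions : Vec (Fin 6 × TreeCertificate 8) 6
  coalitions =
      (# 2 , # 0 , (# 0 ∷ # 1 ∷ # 5 ∷ # 3 ∷ # 4 ∷ # 0 ∷ # 6 ∷ # 7 ∷ []) , (0 ∷ 0 ∷ 2 ∷ 0 ∷ 0 ∷ 1 ∷ 0 ∷ 0 ∷ []))
    ∷ (# 2 , # 1 , (# 0 ∷ # 1 ∷ # 3 ∷ # 1 ∷ # 4 ∷ # 1 ∷ # 6 ∷ # 7 ∷ []) , (0 ∷ 0 ∷ 2 ∷ 1 ∷ 0 ∷ 1 ∷ 0 ∷ 0 ∷ []))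
    ∷ (# 0 , # 0 , (# 0 ∷ # 1 ∷ # 5 ∷ # 3 ∷ # 4 ∷ # 0 ∷ # 6 ∷ # 7 ∷ []) , (0 ∷ 0 ∷ 2 ∷ 0 ∷ 0 ∷ 1 ∷ 0 ∷ 0 ∷ []))
    ∷ (# 2 , # 2 , (# 0 ∷ # 1 ∷ # 2 ∷ # 3 ∷ # 2 ∷ # 2 ∷ # 6 ∷ # 7 ∷ []) , (0 ∷ 0 ∷ 0 ∷ 0 ∷ 1 ∷ 1 ∷ 0 ∷ 0 ∷ []))
    ∷ (# 1 , # 1 , (# 0 ∷ # 1 ∷ # 2 ∷ # 1 ∷ # 4 ∷ # 5 ∷ # 1 ∷ # 7 ∷ []) , (0 ∷ 0 ∷ 0 ∷ 1 ∷ 0 ∷ 0 ∷ 1 ∷ 0 ∷ []))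
    ∷ (# 1 , # 1 , (# 0 ∷ # 1 ∷ # 2 ∷ # 1 ∷ # 4 ∷ # 5 ∷ # 6 ∷ # 3 ∷ []) , (0 ∷ 0 ∷ 0 ∷ 1 ∷ 0 ∷ 0 ∷ 0 ∷ 2 ∷ []))
    ∷ []

  spanning : TreeCertificate 8
  spanning = # 0 , (# 0 ∷ # 5 ∷ # 5 ∷ # 7 ∷ # 6 ∷ # 0 ∷ # 0 ∷ # 0 ∷ []) , (0 ∷ 2 ∷ 2 ∷ 2 ∷ 2 ∷ 1 ∷ 1 ∷ 1 ∷ [])

  extremal-8 : Extremal 8
  extremal-8 = certified-extremal G π refl coalitions (from-yes (certified-partition? G π coalitions))
    spanning (from-yes (isRootedTree? G ⊤ spanning)) (from-yes (all? λ v → degree G v ≤? 3))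

module Order-10 where

  edgeList : List (ℕ × ℕ)
  edgeList = (0 , 4) ∷ (0 , 7) ∷ (0 , 9) ∷ (1 , 2) ∷ (1 , 3) ∷ (1 , 6) ∷ (2 , 4) ∷ (2 , 8)
           ∷ (3 , 4) ∷ (3 , 7) ∷ (5 , 7) ∷ (5 , 8) ∷ (5 , 9) ∷ (6 , 8) ∷ (6 , 9) ∷ []

  G : Graph 10
  G = fromEdgeList 10 edgeList (from-yes (loopless? 10 edgeList))

  classes : Vec (Fin 6) 10
  classes = # 0 ∷ # 1 ∷ # 0 ∷ # 1 ∷ # 0 ∷ # 2 ∷ # 3 ∷ # 1 ∷ # 4 ∷ # 5 ∷ []

  π : Partition G 6
  π = fromClassList G classes (from-yes (nonempty? classes))

  coalitions : Vec (Fin 6 × TreeCertificate 10) 6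
  coalitions =
      (# 1 , # 0 , (# 0 ∷ # 2 ∷ # 4 ∷ # 4 ∷ # 0 ∷ # 5 ∷ # 6 ∷ # 0 ∷ # 8 ∷ # 9 ∷ []) , (0 ∷ 3 ∷ 2 ∷ 2 ∷ 1 ∷ 0 ∷ 0 ∷ 1 ∷ 0 ∷ 0 ∷ []))
    ∷ (# 0 , # 0 , (# 0 ∷ # 2 ∷ # 4 ∷ # 4 ∷ # 0 ∷ # 5 ∷ # 6 ∷ # 0 ∷ # 8 ∷ # 9 ∷ []) , (0 ∷ 3 ∷ 2 ∷ 2 ∷ 1 ∷ 0 ∷ 0 ∷ 1 ∷ 0 ∷ 0 ∷ []))
    ∷ (# 1 , # 1 , (# 0 ∷ # 1 ∷ # 2 ∷ # 1 ∷ # 4 ∷ # 7 ∷ # 6 ∷ # 3 ∷ # 8 ∷ # 9 ∷ []) , (0 ∷ 0 ∷ 0 ∷ 1 ∷ 0 ∷ 3 ∷ 0 ∷ 2 ∷ 0 ∷ 0 ∷ []))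
    ∷ (# 1 , # 1 , (# 0 ∷ # 1 ∷ # 2 ∷ # 1 ∷ # 4 ∷ # 5 ∷ # 1 ∷ # 3 ∷ # 8 ∷ # 9 ∷ []) , (0 ∷ 0 ∷ 0 ∷ 1 ∷ 0 ∷ 0 ∷ 1 ∷ 2 ∷ 0 ∷ 0 ∷ []))
    ∷ (# 0 , # 0 , (# 0 ∷ # 1 ∷ # 4 ∷ # 3 ∷ # 0 ∷ # 5 ∷ # 6 ∷ # 7 ∷ # 2 ∷ # 9 ∷ []) , (0 ∷ 0 ∷ 2 ∷ 0 ∷ 1 ∷ 0 ∷ 0 ∷ 0 ∷ 3 ∷ 0 ∷ []))
    ∷ (# 0 , # 0 , (# 0 ∷ # 1 ∷ # 4 ∷ # 3 ∷ # 0 ∷ # 5 ∷ # 6 ∷ # 7 ∷ # 8 ∷ # 0 ∷ []) , (0 ∷ 0 ∷ 2 ∷ 0 ∷ 1 ∷ 0 ∷ 0 ∷ 0 ∷ 0 ∷ 1 ∷ []))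
    ∷ []

  spanning : TreeCertificate 10
  spanning = # 0 , (# 0 ∷ # 2 ∷ # 4 ∷ # 4 ∷ # 0 ∷ # 7 ∷ # 9 ∷ # 0 ∷ # 2 ∷ # 0 ∷ []) , (0 ∷ 3 ∷ 2 ∷ 2 ∷ 1 ∷ 2 ∷ 2 ∷ 1 ∷ 3 ∷ 1 ∷ [])

  extremal-10 : Extremal 10
  extremal-10 = certified-extremal G π refl coalitions (from-yes (certified-partition? G π coalitions))
    spanning (from-yes (isRootedTree? G ⊤ spanning)) (from-yes (all? λ v → degree G v ≤? 3))

sharpness : (n : ℕ) → (n ≡ 6 ⊎ n ≡ 8 ⊎ 10 ≤ n) → Extremal n
sharpness _ (inj₁ refl)               = Order-6.extremal-6
sharpness _ (inj₂ (inj₁ refl))        = Order-8.extremal-8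
sharpness n (inj₂ (inj₂ 10≤n)) with m≤n⇒m<n∨m≡n 10≤n
... | inj₁ 11≤n = extremal-≥11 n 11≤n
... | inj₂ refl = Order-10.extremal-10

theorem3 :
    ((n : ℕ) (G : Graph n) → Subcubic G →
      ∀ k (π : Partition G k) → IsCCPartition G π → k ≤ bound n)
    × ((n : ℕ) (G : Graph n) → Subcubic G → ∀ k → CCNumberIs G k → 6 < k →
      (π : Partition G k) → IsCCPartition G π →
      Isomorphic (CCGAdj G π) StarAdj)
    × ((n : ℕ) → (n ≡ 6 ⊎ n ≡ 8 ⊎ 10 ≤ n) →
      Σ (Graph n) λ G → Subcubic G × CCNumberIs G (bound n))
theorem3 = cc-upper-bound , (λ n G subcubic k _ → coalition-graph-star n G subcubic k) , sharpness
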